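{- Let $r\le s<n$ be nonnegative integers and let $\mathrm{Pan}_{r,s,n}$ be the panhandle matroid. Then for every nonnegative integer $t$, \[ \mathrm{ehr}_{\mathrm{Pan}_{r,s,n}}(t)=\sum_{m=0}^t\sum_{i=0}^{s-r}(-1)^i\binom{s}{i}\binom{t(s-r-i)+m+s-1-i}{s-1}\binom{m+n-s-1}{m}. \]
   Context: For $r\le s<n$, the panhandle matroid $\mathrm{Pan}_{r,s,n}$ is the rank-$r$ matroid on ground set $[n]=\{1,\dots,n\}$ whose bases are the $r$-subsets $B\subseteq[n]$ with $|B\cap[s]|\ge r-1$. The base polytope of a matroid $M$ on $[n]$ is $\mathcal{P}_M=\mathrm{conv}\{\mathbf{e}_B: B \text{ a basis}\}\subset\mathbb{R}^n$, where $\mathbf{e}_B=\sum_{i\in B}\mathbf{e}_i$. The Ehrhart polynomial is $\mathrm{ehr}_M(t)=|t\mathcal{P}_M\cap\mathbb{Z}^n|$ for nonnegative integers $t$. -}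

module Defs where

open import Data.Nat as ℕ using (ℕ; zero; suc; _∸_; _<ᵇ_)
open import Data.Nat.Combinatorics using (_C_)
open import Data.Integer as ℤ using (ℤ; +_; -[1+_]; -1ℤ)
open import Data.Rational as ℚ using (ℚ; 0ℚ; 1ℚ)
open import Data.Fin using (Fin; toℕ)
open import Data.Fin.Subset using (Subset; _∩_; ∣_∣)
open import Data.Vec using (Vec; lookup; tabulate)
open import Data.Bool using (if_then_else_)
open import Data.List using (List; length; map; foldr)
open import Data.List.Relation.Unary.All using (All)
open import Data.List.Relation.Unary.Unique.Propositional using (Unique)
open import Data.List.Membership.Propositional using (_∈_)
open import Data.Product using (Σ; _×_; proj₁; proj₂)
open import Function.Bundles using (_⇔_)
open import Relation.Binary.PropositionalEquality using (_≡_)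

-- Panhandle matroid Pan_{r,s,n} on ground set [n] (elements Fin n,
-- element j ↔ j+1), subsets of the ground set as Data.Fin.Subset.

initSeg : (n s : ℕ) → Subset n
initSeg n s = tabulate (λ j → toℕ j <ᵇ s)

IsPanBasis : (r s n : ℕ) → Subset n → Set
IsPanBasis r s n B = (∣ B ∣ ≡ r) × (r ∸ 1 ℕ.≤ ∣ B ∩ initSeg n s ∣)

indicator : ∀ {n} → Subset n → Fin n → ℚ
indicator B j = if lookup B j then 1ℚ else 0ℚ

sumℚ : List ℚ → ℚ
sumℚ = foldr ℚ._+_ 0ℚ

-- x ∈ t·P_M, where P_M = conv{e_B : B basis}: x = t · Σ λ_B e_B for a
-- finite family of bases B with weights λ_B ≥ 0 and Σ λ_B = 1.
InPanDilate : (r s n t : ℕ) → Vec ℤ n → Set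
InPanDilate r s n t x =
  Σ (List (ℚ × Subset n)) λ comb →
    All (λ p → IsPanBasis r s n (proj₂ p)) comb ×
    All (λ p → 0ℚ ℚ.≤ proj₁ p) comb ×
    (sumℚ (map proj₁ comb) ≡ 1ℚ) ×
    (∀ j → (lookup x j ℚ./ 1) ≡
       (+ t ℚ./ 1) ℚ.* sumℚ (map (λ p → proj₁ p ℚ.* indicator (proj₂ p) j) comb))

-- ehr_{Pan_{r,s,n}}(t) = k : the set tP ∩ ℤ^n has exactly k elements,
-- i.e. it is enumerated by a duplicate-free list of length k.
PanEhrIs : (r s n t k : ℕ) → Set
PanEhrIs r s n t k =
  Σ (List (Vec ℤ n)) λ xs →
    Unique xs ×
    (∀ x → (x ∈ xs) ⇔ InPanDilate r s n t x) ×
    (length xs ≡ k)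

-- binomial coefficient with integer top, natural bottom, using the
-- combinatorial convention: binom(a, b) = 0 when a < 0.
binomℤ : ℤ → ℕ → ℤ
binomℤ (+ a)    b = + (a C b)
binomℤ -[1+ _ ] b = + 0

sumTo : ℕ → (ℕ → ℤ) → ℤ
sumTo zero    f = f 0
sumTo (suc k) f = sumTo k f ℤ.+ f (suc k)

panRHS : (r s n t : ℕ) → ℤ
panRHS r s n t =
  sumTo t λ m → sumTo (s ∸ r) λ i →
    (-1ℤ ℤ.^ i) ℤ.* (+ (s C i)) ℤ.*
    binomℤ ((+ (t ℕ.* (s ∸ r ∸ i) ℕ.+ m ℕ.+ s)) ℤ.- (+ (1 ℕ.+ i))) (s ∸ 1) ℤ.*
    (+ ((m ℕ.+ n ∸ s ∸ 1) C m))

-- Every integer point x of t·P, written x = (y, z) with y on [s] and z on the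
-- last d = n - s coordinates, has entries in [0, t], total t·r and Σ z ≤ t: these
-- linear inequalities hold for each basis indicator e_B (|B| = r, |B ∖ [s]| ≤ 1)
-- and survive convex combinations. Conversely such a point is the average of t
-- bases, obtained by dealing out coordinate j to x_j of t sets, always to the
-- currently smallest ones; the sets then all have size r, and since Σ z ≤ t at
-- most one element outside [s] each.
--
-- The points with Σ z = m ∈ [0, t] are counted as a product: z is any of the
-- C(m + d - 1, d - 1) compositions of m into d parts, and t - y is a composition
-- of t(s - r) + m into s parts each at most t, which inclusion–exclusion over the
-- parts exceeding t counts as Σ_i (-1)^i C(s, i) C(t(s - r - i) + m + s - 1 - i, s - 1).

module Submission where

open import Defs
open import Data.Nat as ℕ using (ℕ; zero; suc; _∸_; _≤_; _<_; z≤n; s≤s)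
import Data.Nat.Properties as ℕP
import Data.Nat.Tactic.RingSolver as ℕSolver
open import Data.Nat.Combinatorics using (_C_; nCk+nC[k+1]≡[n+1]C[k+1]; k>n⇒nCk≡0; nCk≡nC[n∸k])
open import Data.Nat.Divisibility using (∣1⇒≡1)
open import Data.Nat.ListAction using (sum)
import Data.Nat.ListAction.Properties as ListActionP
open import Data.Integer as ℤ using (ℤ; +_; -[1+_]; +≤+; _+_; _-_; _*_; -_; 0ℤ; 1ℤ; -1ℤ; _^_)
import Data.Integer.Properties as ℤP
open import Data.Integer.Tactic.RingSolver using (solve-∀)
open import Data.Rational as ℚ using (ℚ; mkℚ; 0ℚ; 1ℚ; *≤*; nonNegative)
import Data.Rational.Properties as ℚP
open import Data.Bool using (true; false; if_then_else_)
open import Data.Product using (Σ; ∃; ∃₂; _×_; _,_; proj₁; proj₂)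
open import Data.Sum using (inj₁; inj₂)
open import Data.Empty using (⊥-elim)
open import Data.List as List using (List; []; _∷_; _++_; length; replicate; take; drop; cartesianProductWith)
import Data.List.Properties as ListP
open import Data.List.Membership.Propositional using (_∈_)
open import Data.List.Membership.Propositional.Properties
  using (∈-++⁺ˡ; ∈-++⁺ʳ; ∈-++⁻; ∈-map⁺; ∈-map⁻; ∈-cartesianProductWith⁺; ∈-cartesianProductWith⁻)
open import Data.List.Relation.Unary.Any using (here)
open import Data.List.Relation.Unary.All as All using ([]; _∷_)
import Data.List.Relation.Unary.All.Properties as AllP
import Data.List.Relation.Unary.AllPairs as AllPairs
open import Data.List.Relation.Unary.Unique.Propositional using (Unique)
import Data.List.Relation.Unary.Unique.Propositional.Properties as UniqueP
open import Data.Vec as Vec using (Vec; []; _∷_)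
import Data.Vec.Properties as VecP
open import Data.Vec.Relation.Unary.All as VecAll using ([]; _∷_)
import Data.Vec.Relation.Unary.All.Properties as VecAllP
open import Data.Fin using (Fin; zero; suc)
open import Data.Fin.Subset using (Subset; _∩_; ∁; ⊤; ⊥; ∣_∣)
open import Data.Fin.Subset.Properties using (∣⊥∣≡0; ∩-zeroˡ; ∩-identityʳ)
open import Algebra.Bundles using (CommutativeMonoid)
open import Algebra.Properties.CommutativeSemigroup (CommutativeMonoid.commutativeSemigroup ℚP.+-0-commutativeMonoid)
  using () renaming (interchange to ℚ-+-interchange)
open import Relation.Binary.PropositionalEquality
open import Relation.Binary.Definitions using (tri<; tri≈; tri>)
open import Relation.Nullary using (yes; no)
open import Function.Base using (_∘_)
open import Function.Bundles using (mk⇔)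

sumTo-cong : ∀ K {f g : ℕ → ℤ} → (∀ i → i ≤ K → f i ≡ g i) → sumTo K f ≡ sumTo K g
sumTo-cong zero    f≗g = f≗g 0 z≤n
sumTo-cong (suc K) f≗g =
  cong₂ _+_ (sumTo-cong K (λ i i≤K → f≗g i (ℕP.m≤n⇒m≤1+n i≤K))) (f≗g (suc K) ℕP.≤-refl)

sumTo-zero : ∀ K {f} → (∀ i → i ≤ K → f i ≡ 0ℤ) → sumTo K f ≡ 0ℤ
sumTo-zero zero    f≡0 = f≡0 0 z≤n
sumTo-zero (suc K) f≡0 =
  cong₂ _+_ (sumTo-zero K (λ i i≤K → f≡0 i (ℕP.m≤n⇒m≤1+n i≤K))) (f≡0 (suc K) ℕP.≤-refl)

sumTo-distrib-+ : ∀ K (f g : ℕ → ℤ) → sumTo K (λ i → f i + g i) ≡ sumTo K f + sumTo K g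
sumTo-distrib-+ zero    f g = refl
sumTo-distrib-+ (suc K) f g =
  trans (cong (_+ (f (suc K) + g (suc K))) (sumTo-distrib-+ K f g))
        (interchange (sumTo K f) (sumTo K g) (f (suc K)) (g (suc K)))
  where
  interchange : ∀ a b c d → (a + b) + (c + d) ≡ (a + c) + (b + d)
  interchange = solve-∀

*-distribˡ-sumTo : ∀ K c (f : ℕ → ℤ) → c * sumTo K f ≡ sumTo K (λ i → c * f i)
*-distribˡ-sumTo zero    c f = refl
*-distribˡ-sumTo (suc K) c f =
  trans (ℤP.*-distribˡ-+ c (sumTo K f) (f (suc K))) (cong (_+ c * f (suc K)) (*-distribˡ-sumTo K c f))

*-distribʳ-sumTo : ∀ K c (f : ℕ → ℤ) → sumTo K f * c ≡ sumTo K (λ i → f i * c)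
*-distribʳ-sumTo K c f =
  trans (ℤP.*-comm (sumTo K f) c)
        (trans (*-distribˡ-sumTo K c f) (sumTo-cong K (λ i _ → ℤP.*-comm c (f i))))

sumTo-suc : ∀ K f → sumTo (suc K) f ≡ f 0 + sumTo K (λ i → f (suc i))
sumTo-suc zero    f = refl
sumTo-suc (suc K) f = trans (cong (_+ f (suc (suc K))) (sumTo-suc K f)) (ℤP.+-assoc (f 0) _ _)

sumTo-comm : ∀ K L (f : ℕ → ℕ → ℤ) →
  sumTo K (λ i → sumTo L (f i)) ≡ sumTo L (λ j → sumTo K (λ i → f i j))
sumTo-comm zero    L f = refl
sumTo-comm (suc K) L f =
  trans (cong (_+ sumTo L (f (suc K))) (sumTo-comm K L f)) (sym (sumTo-distrib-+ L _ _))

sumTo-vanishing-tail : ∀ K L f → K ≤ L → (∀ i → K < i → i ≤ L → f i ≡ 0ℤ) → sumTo L f ≡ sumTo K f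
sumTo-vanishing-tail K L f K≤L tail≡0 with ℕP.m≤n⇒m<n∨m≡n K≤L
... | inj₂ refl = refl
sumTo-vanishing-tail K (suc L) f K≤L tail≡0 | inj₁ K<1+L =
  trans (cong₂ _+_ (sumTo-vanishing-tail K L f (ℕP.≤-pred K<1+L)
                      (λ i K<i i≤L → tail≡0 i K<i (ℕP.m≤n⇒m≤1+n i≤L)))
                   (tail≡0 (suc L) K<1+L ℕP.≤-refl))
        (ℤP.+-identityʳ _)

-- Compositions counted by inclusion–exclusion

-- multichoose k M = C(M + k - 1, k - 1) counts the ways of writing M as an
-- ordered sum of k naturals; it vanishes for M < 0.
multichoose : ℕ → ℤ → ℤ
multichoose zero    (+ zero) = 1ℤ
multichoose zero    _        = 0ℤ
multichoose (suc k) M        = binomℤ (M + + k) k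

binomℤ-pascal : ∀ X k → binomℤ (X + 1ℤ) (suc k) ≡ binomℤ X (suc k) + binomℤ X k
binomℤ-pascal (+ a) k rewrite ℕP.+-comm a 1 =
  trans (cong +_ (sym (nCk+nC[k+1]≡[n+1]C[k+1] a k))) (ℤP.+-comm (+ (a C k)) (+ (a C suc k)))
binomℤ-pascal -[1+ zero  ] k = refl
binomℤ-pascal -[1+ suc a ] k = refl

multichoose-pascal : ∀ k M → multichoose (suc k) M ≡ multichoose (suc k) (M - 1ℤ) + multichoose k M
multichoose-pascal zero    (+ zero)  = refl
multichoose-pascal zero    (+ suc a) = refl
multichoose-pascal zero    -[1+ a ]  = refl
multichoose-pascal (suc k) M =
  trans (cong (λ X → binomℤ X (suc k)) (shift₁ M (+ k)))
  (trans (binomℤ-pascal (M + + k) k)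
         (cong (λ X → binomℤ X (suc k) + binomℤ (M + + k) k) (shift₂ M (+ k))))
  where
  shift₁ : ∀ M K → M + (1ℤ + K) ≡ (M + K) + 1ℤ
  shift₁ = solve-∀
  shift₂ : ∀ M K → M + K ≡ (M - 1ℤ) + (1ℤ + K)
  shift₂ = solve-∀

multichoose-window : ∀ k b M →
  sumTo b (λ c → multichoose k (M - + c)) ≡ multichoose (suc k) M - multichoose (suc k) (M - + suc b)
multichoose-window k zero M =
  trans (cong (multichoose k) (ℤP.+-identityʳ M)) (solveFor (multichoose-pascal k M))
  where
  solveFor : ∀ {a b c} → a ≡ b + c → c ≡ a - b
  solveFor {b = b} {c} refl = cancel b c
    where cancel : ∀ b c → c ≡ (b + c) - b
          cancel = solve-∀
multichoose-window k (suc b) M =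
  trans (cong (_+ multichoose k (M - + suc b)) (multichoose-window k b M))
  (trans (cong (λ X → multichoose (suc k) M - X + multichoose k (M - + suc b))
               (multichoose-pascal k (M - + suc b)))
  (trans (cancel (multichoose (suc k) M) (multichoose (suc k) (M - + suc b - 1ℤ)) (multichoose k (M - + suc b)))
         (cong (λ X → multichoose (suc k) M - multichoose (suc k) X) (shift M (+ b)))))
  where
  cancel : ∀ a d c → a - (d + c) + c ≡ a - d
  cancel = solve-∀
  shift : ∀ M B → M - (1ℤ + B) - 1ℤ ≡ M - (1ℤ + (1ℤ + B))
  shift = solve-∀

multichoose-negative : ∀ k a → multichoose k -[1+ a ] ≡ 0ℤ
multichoose-negative zero    a = refl
multichoose-negative (suc k) a with k ℕ.<? suc a
... | yes k<1+a rewrite ℤP.⊖-< k<1+a = negative (suc a ∸ k) (ℕP.m>n⇒m∸n≢0 k<1+a)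
  where
  negative : ∀ n → n ≢ 0 → binomℤ (- (+ n)) k ≡ 0ℤ
  negative zero    n≢0 = ⊥-elim (n≢0 refl)
  negative (suc n) _   = refl
... | no k≮1+a rewrite ℤP.⊖-≥ (ℕP.≮⇒≥ k≮1+a) =
  cong +_ (k>n⇒nCk≡0 (ℕP.∸-monoʳ-< {k} {suc a} {0} (s≤s z≤n) (ℕP.≮⇒≥ k≮1+a)))

signedBinomial : ℕ → ℕ → ℤ
signedBinomial k i = (-1ℤ ^ i) * + (k C i)

signedBinomial-pascal : ∀ k j →
  signedBinomial (suc k) (suc j) ≡ signedBinomial k (suc j) - signedBinomial k j
signedBinomial-pascal k j rewrite sym (nCk+nC[k+1]≡[n+1]C[k+1] k j) =
  expand (-1ℤ ^ j) (+ (k C j)) (+ (k C suc j))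
  where
  expand : ∀ p a b → -1ℤ * p * (a + b) ≡ -1ℤ * p * b - p * a
  expand = solve-∀

signedBinomial-beyond : ∀ k → signedBinomial k (suc k) ≡ 0ℤ
signedBinomial-beyond k rewrite k>n⇒nCk≡0 (ℕP.n<1+n k) = ℤP.*-zeroʳ (-1ℤ ^ suc k)

signedBinomial-summation-by-parts : ∀ k (X : ℕ → ℤ) →
  sumTo k (λ i → signedBinomial k i * (X i - X (suc i))) ≡
  sumTo (suc k) (λ i → signedBinomial (suc k) i * X i)
signedBinomial-summation-by-parts k X =
  begin
    sumTo k (λ i → σ k i * (X i - X (suc i)))
  ≡⟨ sumTo-cong k (λ i _ → ℤP.*-distribˡ-+ (σ k i) (X i) (- X (suc i))) ⟩
    sumTo k (λ i → σ k i * X i + σ k i * - X (suc i))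
  ≡⟨ sumTo-distrib-+ k _ _ ⟩
    sumTo k (λ i → σ k i * X i) + sumTo k (λ i → σ k i * - X (suc i))
  ≡⟨ cong (_+ sumTo k (λ i → σ k i * - X (suc i))) shiftedRow ⟩
    (X 0 + sumTo k (λ i → σ k (suc i) * X (suc i))) + sumTo k (λ i → σ k i * - X (suc i))
  ≡⟨ ℤP.+-assoc (X 0) _ _ ⟩
    X 0 + (sumTo k (λ i → σ k (suc i) * X (suc i)) + sumTo k (λ i → σ k i * - X (suc i)))
  ≡⟨ cong (λ w → X 0 + w) (sym (sumTo-distrib-+ k _ _)) ⟩
    X 0 + sumTo k (λ i → σ k (suc i) * X (suc i) + σ k i * - X (suc i))
  ≡⟨ cong (λ w → X 0 + w) (sumTo-cong k (λ i _ → pascalStep i)) ⟩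
    X 0 + sumTo k (λ i → σ (suc k) (suc i) * X (suc i))
  ≡⟨ cong (_+ sumTo k (λ i → σ (suc k) (suc i) * X (suc i))) (sym (ℤP.*-identityˡ (X 0))) ⟩
    σ (suc k) 0 * X 0 + sumTo k (λ i → σ (suc k) (suc i) * X (suc i))
  ≡⟨ sym (sumTo-suc k (λ i → σ (suc k) i * X i)) ⟩
    sumTo (suc k) (λ i → σ (suc k) i * X i)
  ∎
  where
  open ≡-Reasoning
  σ = signedBinomial
  shiftedRow : sumTo k (λ i → σ k i * X i) ≡ X 0 + sumTo k (λ i → σ k (suc i) * X (suc i))
  shiftedRow =
    begin
      sumTo k (λ i → σ k i * X i)
    ≡⟨ sym (ℤP.+-identityʳ _) ⟩
      sumTo k (λ i → σ k i * X i) + 0ℤ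
    ≡⟨ cong (λ w → sumTo k (λ i → σ k i * X i) + w)
            (sym (trans (cong (_* X (suc k)) (signedBinomial-beyond k)) (ℤP.*-zeroˡ (X (suc k))))) ⟩
      sumTo (suc k) (λ i → σ k i * X i)
    ≡⟨ sumTo-suc k _ ⟩
      σ k 0 * X 0 + sumTo k (λ i → σ k (suc i) * X (suc i))
    ≡⟨ cong (_+ sumTo k (λ i → σ k (suc i) * X (suc i))) (ℤP.*-identityˡ (X 0)) ⟩
      X 0 + sumTo k (λ i → σ k (suc i) * X (suc i))
    ∎
  pascalStep : ∀ i → σ k (suc i) * X (suc i) + σ k i * - X (suc i) ≡ σ (suc k) (suc i) * X (suc i)
  pascalStep i = trans (collect (σ k (suc i)) (σ k i) (X (suc i)))
                       (cong (_* X (suc i)) (sym (signedBinomial-pascal k i)))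
    where collect : ∀ a b x → a * x + b * - x ≡ (a - b) * x
          collect = solve-∀

-- The number of ways of writing M as an ordered sum of k naturals each at
-- most b, by inclusion–exclusion over the parts exceeding b.
cappedMultichoose : ℕ → ℕ → ℤ → ℤ
cappedMultichoose b k M = sumTo k (λ i → signedBinomial k i * multichoose k (M - + (i ℕ.* suc b)))

-- The recursion of the true count, obtained by splitting off the first part c ≤ b.
cappedMultichoose-suc : ∀ b k M →
  sumTo b (λ c → cappedMultichoose b k (M - + c)) ≡ cappedMultichoose b (suc k) M
cappedMultichoose-suc b k M =
  begin
    sumTo b (λ c → sumTo k (λ i → σ k i * multichoose k (M - + c - + (i ℕ.* suc b))))
  ≡⟨ sumTo-comm b k _ ⟩
    sumTo k (λ i → sumTo b (λ c → σ k i * multichoose k (M - + c - + (i ℕ.* suc b))))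
  ≡⟨ sumTo-cong k (λ i _ → sym (trans (*-distribˡ-sumTo b (σ k i) _)
                                        (sumTo-cong b (λ c _ → cong (λ N → σ k i * multichoose k N)
                                                                    (swapSub M (+ (i ℕ.* suc b)) (+ c)))))) ⟩
    sumTo k (λ i → σ k i * sumTo b (λ c → multichoose k (M - + (i ℕ.* suc b) - + c)))
  ≡⟨ sumTo-cong k (λ i _ → cong (σ k i *_) (window i)) ⟩
    sumTo k (λ i → σ k i * (X i - X (suc i)))
  ≡⟨ signedBinomial-summation-by-parts k X ⟩
    cappedMultichoose b (suc k) M
  ∎
  where
  open ≡-Reasoning
  σ = signedBinomial
  X : ℕ → ℤ
  X i = multichoose (suc k) (M - + (i ℕ.* suc b))
  swapSub : ∀ M y c → M - y - c ≡ M - c - y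
  swapSub = solve-∀
  window : ∀ i → sumTo b (λ c → multichoose k (M - + (i ℕ.* suc b) - + c)) ≡ X i - X (suc i)
  window i = trans (multichoose-window k b (M - + (i ℕ.* suc b)))
                   (cong (λ N → X i - multichoose (suc k) N) (nextBlock M (+ (i ℕ.* suc b)) (+ b)))
    where nextBlock : ∀ M y B → M - y - (1ℤ + B) ≡ M - ((1ℤ + B) + y)
          nextBlock = solve-∀

cappedMultichoose-negative : ∀ b k a → cappedMultichoose b k -[1+ a ] ≡ 0ℤ
cappedMultichoose-negative b k a = sumTo-zero k (λ i _ → vanishes i (i ℕ.* suc b))
  where
  vanishes : ∀ i n → signedBinomial k i * multichoose k (-[1+ a ] - + n) ≡ 0ℤ
  vanishes i zero    = trans (cong (signedBinomial k i *_) (multichoose-negative k a)) (ℤP.*-zeroʳ (signedBinomial k i))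
  vanishes i (suc n) = trans (cong (signedBinomial k i *_) (multichoose-negative k _)) (ℤP.*-zeroʳ (signedBinomial k i))

pos-sub-pos-≥ : ∀ m n → n ≤ m → + m - + n ≡ + (m ∸ n)
pos-sub-pos-≥ m n n≤m = trans (ℤP.m-n≡m⊖n m n) (ℤP.⊖-≥ n≤m)

pos-sub-pos-< : ∀ m n → m < n → ∃ λ c → + m - + n ≡ -[1+ c ]
pos-sub-pos-< m n m<n =
  n ∸ m ∸ 1 , trans (ℤP.m-n≡m⊖n m n) (trans (ℤP.⊖-< m<n) (negative (n ∸ m) (ℕP.m>n⇒m∸n≢0 m<n)))
  where
  negative : ∀ k → k ≢ 0 → - (+ k) ≡ -[1+ k ∸ 1 ]
  negative zero    k≢0 = ⊥-elim (k≢0 refl)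
  negative (suc k) _   = refl

module _ {A : Set} where

  concatUpTo : (ℕ → List A) → ℕ → List A
  concatUpTo f zero    = f 0
  concatUpTo f (suc K) = concatUpTo f K ++ f (suc K)

  ∈-concatUpTo⁻ : ∀ f K {v} → v ∈ concatUpTo f K → ∃ λ c → c ≤ K × v ∈ f c
  ∈-concatUpTo⁻ f zero    v∈ = 0 , z≤n , v∈
  ∈-concatUpTo⁻ f (suc K) v∈ with ∈-++⁻ (concatUpTo f K) v∈
  ... | inj₁ v∈′ = let c , c≤K , v∈fc = ∈-concatUpTo⁻ f K v∈′ in c , ℕP.m≤n⇒m≤1+n c≤K , v∈fc
  ... | inj₂ v∈′ = suc K , ℕP.≤-refl , v∈′

  ∈-concatUpTo⁺ : ∀ f K {c v} → c ≤ K → v ∈ f c → v ∈ concatUpTo f K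
  ∈-concatUpTo⁺ f zero    z≤n v∈ = v∈
  ∈-concatUpTo⁺ f (suc K) c≤1+K v∈ with ℕP.m≤n⇒m<n∨m≡n c≤1+K
  ... | inj₁ c<1+K = ∈-++⁺ˡ (∈-concatUpTo⁺ f K (ℕP.≤-pred c<1+K) v∈)
  ... | inj₂ refl  = ∈-++⁺ʳ (concatUpTo f K) v∈

  concatUpTo-unique : ∀ f K → (∀ c → Unique (f c)) → (∀ c c′ {v} → v ∈ f c → v ∈ f c′ → c ≡ c′) →
                      Unique (concatUpTo f K)
  concatUpTo-unique f zero    unique disjoint = unique 0
  concatUpTo-unique f (suc K) unique disjoint =
    UniqueP.++⁺ (concatUpTo-unique f K unique disjoint) (unique (suc K)) λ (v∈ , v∈′) →
      let c , c≤K , v∈fc = ∈-concatUpTo⁻ f K v∈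
      in ℕP.<-irrefl refl (subst (_≤ K) (disjoint c (suc K) v∈fc v∈′) c≤K)

  length-concatUpTo : ∀ f K → + length (concatUpTo f K) ≡ sumTo K (λ c → + length (f c))
  length-concatUpTo f zero    = refl
  length-concatUpTo f (suc K) =
    trans (cong +_ (ListP.length-++ (concatUpTo f K)))
          (cong (_+ + length (f (suc K))) (length-concatUpTo f K))

mutual
  cappedCompositions : (b k N : ℕ) → List (Vec ℕ k)
  cappedCompositions b zero    zero    = [] ∷ []
  cappedCompositions b zero    (suc N) = []
  cappedCompositions b (suc k) N       = concatUpTo (cappedCompositionsFrom b k N) b

  cappedCompositionsFrom : (b k N c : ℕ) → List (Vec ℕ (suc k))
  cappedCompositionsFrom b k N c with c ℕ.≤? N
  ... | yes _ = List.map (c ∷_) (cappedCompositions b k (N ∸ c))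
  ... | no  _ = []

IsCappedComposition : (b N : ℕ) → ∀ {k} → Vec ℕ k → Set
IsCappedComposition b N v = VecAll.All (_≤ b) v × Vec.sum v ≡ N

mutual
  ∈-cappedCompositions⁻ : ∀ b k N {v} → v ∈ cappedCompositions b k N → IsCappedComposition b N v
  ∈-cappedCompositions⁻ b zero    zero    (here refl) = [] , refl
  ∈-cappedCompositions⁻ b (suc k) N       v∈ =
    let c , c≤b , v∈′ = ∈-concatUpTo⁻ (cappedCompositionsFrom b k N) b v∈
    in ∈-cappedCompositionsFrom⁻ b k N c c≤b v∈′

  ∈-cappedCompositionsFrom⁻ : ∀ b k N c {v} → c ≤ b → v ∈ cappedCompositionsFrom b k N c →
                              IsCappedComposition b N v
  ∈-cappedCompositionsFrom⁻ b k N c c≤b v∈ with c ℕ.≤? N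
  ... | yes c≤N with ∈-map⁻ (c ∷_) v∈
  ...   | w , w∈ , refl =
    let w≤b , Σw≡N∸c = ∈-cappedCompositions⁻ b k (N ∸ c) w∈
    in c≤b ∷ w≤b , trans (cong (c ℕ.+_) Σw≡N∸c) (ℕP.m+[n∸m]≡n c≤N)

∈-cappedCompositions⁺ : ∀ b k N (v : Vec ℕ k) → IsCappedComposition b N v → v ∈ cappedCompositions b k N
∈-cappedCompositions⁺ b zero    .zero []      ([] , refl) = here refl
∈-cappedCompositions⁺ b (suc k) N     (c ∷ w) (c≤b ∷ w≤b , c+Σw≡N) =
  ∈-concatUpTo⁺ (cappedCompositionsFrom b k N) b c≤b ∈-from
  where
  c≤N : c ≤ N
  c≤N = subst (c ≤_) c+Σw≡N (ℕP.m≤m+n c (Vec.sum w))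
  Σw≡N∸c : Vec.sum w ≡ N ∸ c
  Σw≡N∸c = trans (sym (ℕP.m+n∸m≡n c (Vec.sum w))) (cong (_∸ c) c+Σw≡N)
  ∈-from : c ∷ w ∈ cappedCompositionsFrom b k N c
  ∈-from with c ℕ.≤? N
  ... | yes _   = ∈-map⁺ (c ∷_) (∈-cappedCompositions⁺ b k (N ∸ c) w (w≤b , Σw≡N∸c))
  ... | no  c≰N = ⊥-elim (c≰N c≤N)

head-cappedCompositionsFrom : ∀ b k N c {v} → v ∈ cappedCompositionsFrom b k N c → Vec.head v ≡ c
head-cappedCompositionsFrom b k N c v∈ with c ℕ.≤? N
... | yes _ with ∈-map⁻ (c ∷_) v∈
...   | _ , _ , refl = refl

mutual
  cappedCompositions-unique : ∀ b k N → Unique (cappedCompositions b k N)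
  cappedCompositions-unique b zero    zero    = All.[] AllPairs.∷ AllPairs.[]
  cappedCompositions-unique b zero    (suc N) = AllPairs.[]
  cappedCompositions-unique b (suc k) N       =
    concatUpTo-unique (cappedCompositionsFrom b k N) b (cappedCompositionsFrom-unique b k N)
      λ c c′ v∈ v∈′ → trans (sym (head-cappedCompositionsFrom b k N c v∈))
                            (head-cappedCompositionsFrom b k N c′ v∈′)

  cappedCompositionsFrom-unique : ∀ b k N c → Unique (cappedCompositionsFrom b k N c)
  cappedCompositionsFrom-unique b k N c with c ℕ.≤? N
  ... | yes _ = UniqueP.map⁺ VecP.∷-injectiveʳ (cappedCompositions-unique b k (N ∸ c))
  ... | no  _ = AllPairs.[]

mutual
  length-cappedCompositions : ∀ b k N → + length (cappedCompositions b k N) ≡ cappedMultichoose b k (+ N)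
  length-cappedCompositions b zero    zero    = refl
  length-cappedCompositions b zero    (suc N) = refl
  length-cappedCompositions b (suc k) N       =
    trans (length-concatUpTo (cappedCompositionsFrom b k N) b)
          (trans (sumTo-cong b (λ c _ → length-cappedCompositionsFrom b k N c))
                 (cappedMultichoose-suc b k (+ N)))

  length-cappedCompositionsFrom : ∀ b k N c →
    + length (cappedCompositionsFrom b k N c) ≡ cappedMultichoose b k (+ N - + c)
  length-cappedCompositionsFrom b k N c with c ℕ.≤? N
  ... | yes c≤N rewrite pos-sub-pos-≥ N c c≤N =
    trans (cong +_ (ListP.length-map (c ∷_) (cappedCompositions b k (N ∸ c))))
          (length-cappedCompositions b k (N ∸ c))
  ... | no c≰N rewrite proj₂ (pos-sub-pos-< N c (ℕP.≰⇒> c≰N)) =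
    sym (cappedMultichoose-negative b k _)

-- The lattice points of t·Pan and their enumeration

length-cartesianProductWith : ∀ {A B C : Set} (f : A → B → C) xs ys →
  length (cartesianProductWith f xs ys) ≡ length xs ℕ.* length ys
length-cartesianProductWith f []       ys = refl
length-cartesianProductWith f (x ∷ xs) ys =
  trans (ListP.length-++ (List.map (f x) ys))
        (cong₂ ℕ._+_ (ListP.length-map (f x) ys) (length-cartesianProductWith f xs ys))

map-injective : ∀ {A B : Set} {f : A → B} → (∀ {a b} → f a ≡ f b → a ≡ b) →
                ∀ {k} {u v : Vec A k} → Vec.map f u ≡ Vec.map f v → u ≡ v
map-injective f-inj {u = []}    {[]}    _  = refl
map-injective f-inj {u = a ∷ u} {b ∷ v} eq =
  cong₂ _∷_ (f-inj (VecP.∷-injectiveˡ eq)) (map-injective f-inj (VecP.∷-injectiveʳ eq))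

entries-≤-sum : ∀ {k} (z : Vec ℕ k) → VecAll.All (_≤ Vec.sum z) z
entries-≤-sum []      = []
entries-≤-sum (a ∷ z) =
  ℕP.m≤m+n a (Vec.sum z) ∷ VecAll.map (λ b≤ → ℕP.≤-trans b≤ (ℕP.m≤n+m (Vec.sum z) a)) (entries-≤-sum z)

module _ (t : ℕ) where

  complement : ∀ {k} → Vec ℕ k → Vec ℕ k
  complement = Vec.map (t ∸_)

  complement-≤ : ∀ {k} (w : Vec ℕ k) → VecAll.All (_≤ t) (complement w)
  complement-≤ []      = []
  complement-≤ (a ∷ w) = ℕP.m∸n≤m t a ∷ complement-≤ w

  complement-involutive : ∀ {k} (w : Vec ℕ k) → VecAll.All (_≤ t) w → complement (complement w) ≡ w
  complement-involutive []      []           = refl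
  complement-involutive (a ∷ w) (a≤t ∷ w≤t) = cong₂ _∷_ (ℕP.m∸[m∸n]≡n a≤t) (complement-involutive w w≤t)

  sum-complement : ∀ {k} (w : Vec ℕ k) → VecAll.All (_≤ t) w → Vec.sum (complement w) ℕ.+ Vec.sum w ≡ k ℕ.* t
  sum-complement []      []           = refl
  sum-complement (a ∷ w) (a≤t ∷ w≤t) =
    trans (interchange (t ∸ a) (Vec.sum (complement w)) a (Vec.sum w))
          (cong₂ ℕ._+_ (ℕP.m∸n+n≡m a≤t) (sum-complement w w≤t))
    where interchange : ∀ p q u v → (p ℕ.+ q) ℕ.+ (u ℕ.+ v) ≡ (p ℕ.+ u) ℕ.+ (q ℕ.+ v)
          interchange = ℕSolver.solve-∀

  -- Computed in ℤ so that it is injective in w even where w exceeds t.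
  assemble : ∀ {s d} → Vec ℕ s → Vec ℕ d → Vec ℤ (s ℕ.+ d)
  assemble w z = Vec.map (λ a → + t - + a) w Vec.++ Vec.map +_ z

  assemble-complement : ∀ {s d} (w : Vec ℕ s) (z : Vec ℕ d) → VecAll.All (_≤ t) w →
                        assemble w z ≡ Vec.map +_ (complement w Vec.++ z)
  assemble-complement w z w≤t =
    trans (cong (Vec._++ Vec.map +_ z) (entrywise w w≤t)) (sym (VecP.map-++ +_ (complement w) z))
    where
    entrywise : ∀ {k} (w : Vec ℕ k) → VecAll.All (_≤ t) w → Vec.map (λ a → + t - + a) w ≡ Vec.map +_ (complement w)
    entrywise []      []           = refl
    entrywise (a ∷ w) (a≤t ∷ w≤t) = cong₂ _∷_ (pos-sub-pos-≥ t a a≤t) (entrywise w w≤t)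

  assemble-injective : ∀ {s d} {w w′ : Vec ℕ s} {z z′ : Vec ℕ d} → assemble w z ≡ assemble w′ z′ → w ≡ w′ × z ≡ z′
  assemble-injective {w = w} {w′} eq =
    let eqʷ , eqᶻ = VecP.++-injective (Vec.map (λ a → + t - + a) w) (Vec.map (λ a → + t - + a) w′) eq
    in map-injective t-minus-injective eqʷ , map-injective ℤP.+-injective eqᶻ
    where
    t-minus-injective : ∀ {a b} → + t - + a ≡ + t - + b → a ≡ b
    t-minus-injective {a} {b} eq =
      ℤP.+-injective (trans (twice (+ t) (+ a)) (trans (cong (λ u → + t - u) eq) (sym (twice (+ t) (+ b)))))
      where twice : ∀ T A → A ≡ T - (T - A)
            twice = solve-∀

PanLatticePoint : (r s d t : ℕ) → Vec ℤ (s ℕ.+ d) → Set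
PanLatticePoint r s d t x = Σ (Vec ℕ s) λ y → Σ (Vec ℕ d) λ z →
  x ≡ Vec.map +_ (y Vec.++ z) × VecAll.All (_≤ t) y × Vec.sum y ℕ.+ Vec.sum z ≡ t ℕ.* r × Vec.sum z ≤ t

module PanLatticePoints (r s d t : ℕ) where

  complements : ℕ → List (Vec ℕ s)
  complements m = cappedCompositions t s (t ℕ.* (s ∸ r) ℕ.+ m)

  outsides : ℕ → List (Vec ℕ d)
  outsides m = cappedCompositions m d m

  -- Σ z = m forces Σ y = t·r - m, so the complement t - y has total t·(s - r) + m.
  withOutsideSum : ℕ → List (Vec ℤ (s ℕ.+ d))
  withOutsideSum m =
    cartesianProductWith (assemble t) (complements m) (outsides m)

  panLatticePoints : List (Vec ℤ (s ℕ.+ d))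
  panLatticePoints = concatUpTo withOutsideSum t

  outsideSum : ∀ m {x} → x ∈ withOutsideSum m → ∃₂ λ w z → x ≡ assemble t {s} {d} w z × Vec.sum z ≡ m
  outsideSum m x∈ =
    let w , z , _ , z∈ , eq = ∈-cartesianProductWith⁻ (assemble t) (complements m) (outsides m) x∈
    in w , z , eq , proj₂ (∈-cappedCompositions⁻ m d m z∈)

  panLatticePoints-unique : Unique panLatticePoints
  panLatticePoints-unique =
    concatUpTo-unique withOutsideSum t
      (λ m → UniqueP.cartesianProductWith⁺ (assemble t) (assemble-injective t {s} {d})
               (cappedCompositions-unique t s _) (cappedCompositions-unique m d m))
      λ m m′ x∈ x∈′ →
        let w  , z  , eq  , Σz≡m  = outsideSum m  x∈
            w′ , z′ , eq′ , Σz′≡m′ = outsideSum m′ x∈′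
            z≡z′ = proj₂ (assemble-injective t {s} {d} {w} {w′} {z} {z′} (trans (sym eq) eq′))
        in trans (sym Σz≡m) (trans (cong Vec.sum z≡z′) Σz′≡m′)

  module _ (r≤s : r ≤ s) where

    private
      D = s ∸ r

      s≡D+r : s ≡ D ℕ.+ r
      s≡D+r = sym (ℕP.m∸n+n≡m r≤s)

    inside-total : ∀ Y m → Y ℕ.+ (t ℕ.* D ℕ.+ m) ≡ s ℕ.* t → Y ℕ.+ m ≡ t ℕ.* r
    inside-total Y m total = ℕP.+-cancelʳ-≡ (t ℕ.* D) (Y ℕ.+ m) (t ℕ.* r)
      (trans (reorder Y m t D) (trans total (trans (cong (ℕ._* t) s≡D+r) (expand D r t))))
      where
      reorder : ∀ Y m t D → Y ℕ.+ m ℕ.+ t ℕ.* D ≡ Y ℕ.+ (t ℕ.* D ℕ.+ m)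
      reorder = ℕSolver.solve-∀
      expand : ∀ D r t → (D ℕ.+ r) ℕ.* t ≡ t ℕ.* r ℕ.+ t ℕ.* D
      expand = ℕSolver.solve-∀

    complement-total : ∀ W Y Z → W ℕ.+ Y ≡ s ℕ.* t → Y ℕ.+ Z ≡ t ℕ.* r → W ≡ t ℕ.* D ℕ.+ Z
    complement-total W Y Z W+Y≡st Y+Z≡tr = ℕP.+-cancelʳ-≡ Y W (t ℕ.* D ℕ.+ Z)
      (trans W+Y≡st (trans (cong (ℕ._* t) s≡D+r)
        (trans (expand D r t) (trans (cong (t ℕ.* D ℕ.+_) (sym Y+Z≡tr)) (reorder (t ℕ.* D) Y Z)))))
      where
      expand : ∀ D r t → (D ℕ.+ r) ℕ.* t ≡ t ℕ.* D ℕ.+ t ℕ.* r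
      expand = ℕSolver.solve-∀
      reorder : ∀ a Y Z → a ℕ.+ (Y ℕ.+ Z) ≡ a ℕ.+ Z ℕ.+ Y
      reorder = ℕSolver.solve-∀

    ∈-panLatticePoints⁻ : ∀ {x} → x ∈ panLatticePoints → PanLatticePoint r s d t x
    ∈-panLatticePoints⁻ x∈ =
      let m , m≤t , x∈m            = ∈-concatUpTo⁻ withOutsideSum t x∈
          w , z , w∈ , z∈ , x≡     = ∈-cartesianProductWith⁻ (assemble t) (complements m) (outsides m) x∈m
          w≤t , Σw≡tD+m            = ∈-cappedCompositions⁻ t s _ w∈
          _   , Σz≡m               = ∈-cappedCompositions⁻ m d m z∈
      in complement t w , z ,
         trans x≡ (assemble-complement t w z w≤t) ,
         complement-≤ t w ,
         trans (cong (Vec.sum (complement t w) ℕ.+_) Σz≡m)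
               (inside-total _ m (trans (cong (Vec.sum (complement t w) ℕ.+_) (sym Σw≡tD+m))
                                        (sum-complement t w w≤t))) ,
         subst (_≤ t) (sym Σz≡m) m≤t

    ∈-panLatticePoints⁺ : ∀ {x} → PanLatticePoint r s d t x → x ∈ panLatticePoints
    ∈-panLatticePoints⁺ (y , z , refl , y≤t , Σy+Σz≡tr , Σz≤t) =
      subst (_∈ panLatticePoints) assembled
        (∈-concatUpTo⁺ withOutsideSum t Σz≤t (∈-cartesianProductWith⁺ (assemble t) w∈ z∈))
      where
      w∈ : complement t y ∈ complements (Vec.sum z)
      w∈ = ∈-cappedCompositions⁺ t s _ _
             (complement-≤ t y , complement-total _ (Vec.sum y) (Vec.sum z) (sum-complement t y y≤t) Σy+Σz≡tr)
      z∈ : z ∈ outsides (Vec.sum z)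
      z∈ = ∈-cappedCompositions⁺ (Vec.sum z) d (Vec.sum z) z (entries-≤-sum z , refl)
      assembled : assemble t (complement t y) z ≡ Vec.map +_ (y Vec.++ z)
      assembled = trans (assemble-complement t (complement t y) z (complement-≤ t y))
                        (cong (λ w → Vec.map +_ (w Vec.++ z)) (complement-involutive t y y≤t))

cappedMultichoose-truncate : ∀ b k K M → K ≤ k → M < suc K ℕ.* suc b →
  cappedMultichoose b k (+ M) ≡ sumTo K (λ i → signedBinomial k i * multichoose k (+ M - + (i ℕ.* suc b)))
cappedMultichoose-truncate b k K M K≤k M<[K+1][b+1] = sumTo-vanishing-tail K k _ K≤k vanishes
  where
  vanishes : ∀ i → K < i → i ≤ k → signedBinomial k i * multichoose k (+ M - + (i ℕ.* suc b)) ≡ 0ℤ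
  vanishes i K<i _ =
    let c , M-ib≡-[1+c] = pos-sub-pos-< M (i ℕ.* suc b)
                            (ℕP.<-≤-trans M<[K+1][b+1] (ℕP.*-monoˡ-≤ (suc b) K<i))
    in trans (cong (λ N → signedBinomial k i * multichoose k N) M-ib≡-[1+c])
             (trans (cong (signedBinomial k i *_) (multichoose-negative k c)) (ℤP.*-zeroʳ (signedBinomial k i)))

cappedMultichoose-uncapped : ∀ m d′ → cappedMultichoose m (suc d′) (+ m) ≡ + ((m ℕ.+ d′) C d′)
cappedMultichoose-uncapped m d′ =
  trans (cappedMultichoose-truncate m (suc d′) 0 m z≤n (s≤s (ℕP.≤-reflexive (sym (ℕP.+-identityʳ m)))))
        (trans (ℤP.*-identityˡ _) (cong (λ a → binomℤ (+ (a ℕ.+ d′)) d′) (ℕP.+-identityʳ m)))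

complement-term : ∀ t D i m s′ → i ≤ D →
  (+ (t ℕ.* D ℕ.+ m) - + (i ℕ.* suc t)) + + s′ ≡ + (t ℕ.* (D ∸ i) ℕ.+ m ℕ.+ suc s′) - + (1 ℕ.+ i)
complement-term t D i m s′ i≤D =
  begin
    (+ (t ℕ.* D ℕ.+ m) - + (i ℕ.* suc t)) + + s′
  ≡⟨ cong (λ E → (+ (t ℕ.* E ℕ.+ m) - + (i ℕ.* suc t)) + + s′) (sym (ℕP.m∸n+n≡m i≤D)) ⟩
    (+ (t ℕ.* (e ℕ.+ i)) + + m - + (i ℕ.* suc t)) + + s′
  ≡⟨ cong₂ (λ a b → (a + + m - b) + + s′) (ℤP.pos-* t (e ℕ.+ i)) (ℤP.pos-* i (suc t)) ⟩
    (+ t * (+ e + + i) + + m - + i * (1ℤ + + t)) + + s′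
  ≡⟨ rearrange (+ t) (+ e) (+ i) (+ m) (+ s′) ⟩
    + t * + e + + m + (1ℤ + + s′) - (1ℤ + + i)
  ≡⟨ cong (λ a → a + + m + (1ℤ + + s′) - (1ℤ + + i)) (sym (ℤP.pos-* t e)) ⟩
    + (t ℕ.* (D ∸ i) ℕ.+ m ℕ.+ suc s′) - + (1 ℕ.+ i)
  ∎
  where
  open ≡-Reasoning
  e = D ∸ i
  rearrange : ∀ T E I M S → (T * (E + I) + M - I * (1ℤ + T)) + S ≡ T * E + M + (1ℤ + S) - (1ℤ + I)
  rearrange = solve-∀

cappedMultichoose-complements : ∀ t s′ D m → D ≤ suc s′ → m ≤ t →
  cappedMultichoose t (suc s′) (+ (t ℕ.* D ℕ.+ m)) ≡
  sumTo D (λ i → signedBinomial (suc s′) i * binomℤ (+ (t ℕ.* (D ∸ i) ℕ.+ m ℕ.+ suc s′) - + (1 ℕ.+ i)) s′)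
cappedMultichoose-complements t s′ D m D≤s m≤t =
  trans (cappedMultichoose-truncate t (suc s′) D (t ℕ.* D ℕ.+ m) D≤s tD+m<[D+1][t+1])
        (sumTo-cong D (λ i i≤D → cong (λ N → signedBinomial (suc s′) i * binomℤ N s′) (complement-term t D i m s′ i≤D)))
  where
  tD+m<[D+1][t+1] : t ℕ.* D ℕ.+ m < suc D ℕ.* suc t
  tD+m<[D+1][t+1] = s≤s (begin
    t ℕ.* D ℕ.+ m       ≤⟨ ℕP.+-monoʳ-≤ (t ℕ.* D) m≤t ⟩
    t ℕ.* D ℕ.+ t       ≤⟨ ℕP.m≤m+n (t ℕ.* D ℕ.+ t) D ⟩
    t ℕ.* D ℕ.+ t ℕ.+ D ≡⟨ expand t D ⟩
    t ℕ.+ D ℕ.* suc t   ∎)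
    where
    open ℕP.≤-Reasoning
    expand : ∀ t D → t ℕ.* D ℕ.+ t ℕ.+ D ≡ t ℕ.+ D ℕ.* suc t
    expand = ℕSolver.solve-∀

outside-binomial : ∀ m s′ d′ → (m ℕ.+ (suc s′ ℕ.+ suc d′) ∸ suc s′ ∸ 1) C m ≡ (m ℕ.+ d′) C d′
outside-binomial m s′ d′ =
  trans (cong (λ a → (a ∸ suc s′ ∸ 1) C m) (reorder m s′ d′))
        (trans (cong (λ a → (a ∸ 1) C m) (ℕP.m+n∸m≡n (suc s′) (suc (m ℕ.+ d′))))
               (trans (nCk≡nC[n∸k] (ℕP.m≤m+n m d′)) (cong ((m ℕ.+ d′) C_) (ℕP.m+n∸m≡n m d′))))
  where reorder : ∀ m s′ d′ → m ℕ.+ (suc s′ ℕ.+ suc d′) ≡ suc s′ ℕ.+ suc (m ℕ.+ d′)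
        reorder = ℕSolver.solve-∀

length-panLatticePoints : ∀ r s′ d′ t → r ≤ suc s′ →
  + length (PanLatticePoints.panLatticePoints r (suc s′) (suc d′) t) ≡ panRHS r (suc s′) (suc s′ ℕ.+ suc d′) t
length-panLatticePoints r s′ d′ t r≤s =
  trans (length-concatUpTo withOutsideSum t) (sumTo-cong t λ m m≤t →
    begin
      + length (withOutsideSum m)
    ≡⟨ trans (cong +_ (length-cartesianProductWith (assemble t) (complements m) (outsides m)))
             (ℤP.pos-* (length (complements m)) (length (outsides m))) ⟩
      + length (complements m) * + length (outsides m)
    ≡⟨ cong₂ _*_ (length-cappedCompositions t s _) (length-cappedCompositions m d m) ⟩
      cappedMultichoose t s (+ (t ℕ.* D ℕ.+ m)) * cappedMultichoose m d (+ m)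
    ≡⟨ cong₂ _*_ (cappedMultichoose-complements t s′ D m (ℕP.m∸n≤m s r) m≤t)
                 (trans (cappedMultichoose-uncapped m d′) (cong +_ (sym (outside-binomial m s′ d′)))) ⟩
      sumTo D (λ i → signedBinomial s i * binomℤ (+ (t ℕ.* (D ∸ i) ℕ.+ m ℕ.+ s) - + (1 ℕ.+ i)) s′)
        * + ((m ℕ.+ (s ℕ.+ d) ∸ s ∸ 1) C m)
    ≡⟨ *-distribʳ-sumTo D _ _ ⟩
      sumTo D (λ i → signedBinomial s i * binomℤ (+ (t ℕ.* (D ∸ i) ℕ.+ m ℕ.+ s) - + (1 ℕ.+ i)) s′
                       * + ((m ℕ.+ (s ℕ.+ d) ∸ s ∸ 1) C m))
    ∎)
  where
  open ≡-Reasoning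
  s = suc s′
  d = suc d′
  D = s ∸ r
  open PanLatticePoints r s d t

fromℤ : ℤ → ℚ
fromℤ i = i ℚ./ 1

fromℤ-mkℚ : ∀ i → fromℤ i ≡ mkℚ i 0 (λ (_ , d∣1) → ∣1⇒≡1 d∣1)
fromℤ-mkℚ i = ℚP.↥p/↧p≡p (mkℚ i 0 (λ (_ , d∣1) → ∣1⇒≡1 d∣1))

fromℤ-+ : ∀ a b → fromℤ (a ℤ.+ b) ≡ fromℤ a ℚ.+ fromℤ b
fromℤ-+ a b = sym (trans (cong₂ ℚ._+_ (fromℤ-mkℚ a) (fromℤ-mkℚ b))
                         (cong (ℚ._/ 1) (cong₂ ℤ._+_ (ℤP.*-identityʳ a) (ℤP.*-identityʳ b))))

fromℤ-* : ∀ a b → fromℤ (a ℤ.* b) ≡ fromℤ a ℚ.* fromℤ b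
fromℤ-* a b = sym (cong₂ ℚ._*_ (fromℤ-mkℚ a) (fromℤ-mkℚ b))

fromℤ-mono-≤ : ∀ {a b} → a ℤ.≤ b → fromℤ a ℚ.≤ fromℤ b
fromℤ-mono-≤ {a} {b} a≤b rewrite fromℤ-mkℚ a | fromℤ-mkℚ b =
  *≤* (subst₂ ℤ._≤_ (sym (ℤP.*-identityʳ a)) (sym (ℤP.*-identityʳ b)) a≤b)

fromℤ-cancel-≤ : ∀ {a b} → fromℤ a ℚ.≤ fromℤ b → a ℤ.≤ b
fromℤ-cancel-≤ {a} {b} a≤b rewrite fromℤ-mkℚ a | fromℤ-mkℚ b =
  subst₂ ℤ._≤_ (ℤP.*-identityʳ a) (ℤP.*-identityʳ b) (ℚP.drop-*≤* a≤b)

fromℤ-injective : ∀ {a b} → fromℤ a ≡ fromℤ b → a ≡ b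
fromℤ-injective {a} {b} eq =
  ℤP.≤-antisym (fromℤ-cancel-≤ {a} {b} (ℚP.≤-reflexive eq)) (fromℤ-cancel-≤ {b} {a} (ℚP.≤-reflexive (sym eq)))

fromℕ-nonNegative : ∀ n → 0ℚ ℚ.≤ fromℤ (+ n)
fromℕ-nonNegative n = fromℤ-mono-≤ {+ 0} {+ n} (+≤+ ℕ.z≤n)

0≤1 : 0ℚ ℚ.≤ 1ℚ
0≤1 = fromℕ-nonNegative 1

indicator-bounds : ∀ {n} (B : Subset n) j → 0ℚ ℚ.≤ indicator B j × indicator B j ℚ.≤ 1ℚ
indicator-bounds B j with Vec.lookup B j
... | true  = 0≤1 , ℚP.≤-refl
... | false = ℚP.≤-refl , 0≤1

scale-bounds : ∀ t q → 0ℚ ℚ.≤ q → q ℚ.≤ 1ℚ → 0ℚ ℚ.≤ fromℤ (+ t) ℚ.* q × fromℤ (+ t) ℚ.* q ℚ.≤ fromℤ (+ t)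
scale-bounds t q 0≤q q≤1 =
  let instance _ = nonNegative (fromℕ-nonNegative t)
               _ = nonNegative 0≤q
  in ℚP.nonNegative⁻¹ _ {{ℚP.nonNeg*nonNeg⇒nonNeg (fromℤ (+ t)) q}} ,
     subst (fromℤ (+ t) ℚ.* q ℚ.≤_) (ℚP.*-identityʳ _) (ℚP.*-monoˡ-≤-nonNeg (fromℤ (+ t)) q≤1)

weightedSum : ∀ {A : Set} → (A → ℚ) → List (ℚ × A) → ℚ
weightedSum c comb = sumℚ (List.map (λ p → proj₁ p ℚ.* c (proj₂ p)) comb)

weightedSum-bounds : ∀ {A : Set} (c : A → ℚ) (comb : List (ℚ × A)) →
  All.All (λ p → 0ℚ ℚ.≤ proj₁ p) comb → All.All (λ p → 0ℚ ℚ.≤ c (proj₂ p) × c (proj₂ p) ℚ.≤ 1ℚ) comb →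
  0ℚ ℚ.≤ weightedSum c comb × weightedSum c comb ℚ.≤ sumℚ (List.map proj₁ comb)
weightedSum-bounds c []              []          []                   = ℚP.≤-refl , ℚP.≤-refl
weightedSum-bounds c ((λ₀ , a) ∷ comb) (0≤λ₀ ∷ 0≤λ) ((0≤ca , ca≤1) ∷ bounds) =
  let 0≤rest , rest≤Σλ = weightedSum-bounds c comb 0≤λ bounds
      instance _ = nonNegative 0≤λ₀
               _ = nonNegative 0≤ca
  in subst (ℚ._≤ (λ₀ ℚ.* c a ℚ.+ weightedSum c comb)) (ℚP.+-identityˡ 0ℚ)
       (ℚP.+-mono-≤ (ℚP.nonNegative⁻¹ (λ₀ ℚ.* c a) {{ℚP.nonNeg*nonNeg⇒nonNeg λ₀ (c a)}}) 0≤rest) ,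
     ℚP.+-mono-≤ (subst (λ₀ ℚ.* c a ℚ.≤_) (ℚP.*-identityʳ λ₀) (ℚP.*-monoˡ-≤-nonNeg λ₀ ca≤1)) rest≤Σλ

weightedSum-constant : ∀ {A : Set} (c : A → ℚ) k (comb : List (ℚ × A)) →
  All.All (λ p → c (proj₂ p) ≡ k) comb → weightedSum c comb ≡ sumℚ (List.map proj₁ comb) ℚ.* k
weightedSum-constant c k []              []             = sym (ℚP.*-zeroˡ k)
weightedSum-constant c k ((λ₀ , a) ∷ comb) (ca≡k ∷ c≡k) =
  trans (cong₂ ℚ._+_ (cong (λ₀ ℚ.*_) ca≡k) (weightedSum-constant c k comb c≡k))
        (sym (ℚP.*-distribʳ-+ k λ₀ _))

indicatorVec : ∀ {k} → Subset k → Vec ℚ k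
indicatorVec = Vec.map (λ b → if b then 1ℚ else 0ℚ)

combination : ∀ {n} → List (ℚ × Subset n) → Vec ℚ n
combination []      = Vec.replicate _ 0ℚ
combination (p ∷ c) = Vec.zipWith ℚ._+_ (Vec.map (proj₁ p ℚ.*_) (indicatorVec (proj₂ p))) (combination c)

lookup-combination : ∀ {n} (comb : List (ℚ × Subset n)) j →
  Vec.lookup (combination comb) j ≡ weightedSum (λ B → indicator B j) comb
lookup-combination []         j = VecP.lookup-replicate j 0ℚ
lookup-combination (p ∷ comb) j =
  trans (VecP.lookup-zipWith ℚ._+_ j (Vec.map (proj₁ p ℚ.*_) (indicatorVec (proj₂ p))) (combination comb))
        (cong₂ ℚ._+_ (trans (VecP.lookup-map j (proj₁ p ℚ.*_) (indicatorVec (proj₂ p)))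
                            (cong (proj₁ p ℚ.*_) (VecP.lookup-map j (λ b → if b then 1ℚ else 0ℚ) (proj₂ p))))
                     (lookup-combination comb j))

maskedSum : ∀ {k} → Subset k → Vec ℚ k → ℚ
maskedSum []          []       = 0ℚ
maskedSum (true ∷ m)  (v ∷ vs) = v ℚ.+ maskedSum m vs
maskedSum (false ∷ m) (v ∷ vs) = maskedSum m vs

maskedSumℕ : ∀ {k} → Subset k → Vec ℕ k → ℕ
maskedSumℕ []          []       = 0
maskedSumℕ (true ∷ m)  (v ∷ vs) = v ℕ.+ maskedSumℕ m vs
maskedSumℕ (false ∷ m) (v ∷ vs) = maskedSumℕ m vs

maskedSum-zipWith-+ : ∀ {k} (m : Subset k) u v →
  maskedSum m (Vec.zipWith ℚ._+_ u v) ≡ maskedSum m u ℚ.+ maskedSum m v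
maskedSum-zipWith-+ []          []      []      = sym (ℚP.+-identityʳ 0ℚ)
maskedSum-zipWith-+ (true ∷ m)  (a ∷ u) (b ∷ v) = trans (cong (a ℚ.+ b ℚ.+_) (maskedSum-zipWith-+ m u v)) (ℚ-+-interchange a b _ _)
maskedSum-zipWith-+ (false ∷ m) (a ∷ u) (b ∷ v) = maskedSum-zipWith-+ m u v

maskedSum-scale : ∀ {k} (m : Subset k) c u → maskedSum m (Vec.map (c ℚ.*_) u) ≡ c ℚ.* maskedSum m u
maskedSum-scale []          c []      = sym (ℚP.*-zeroʳ c)
maskedSum-scale (true ∷ m)  c (a ∷ u) = trans (cong (c ℚ.* a ℚ.+_) (maskedSum-scale m c u)) (sym (ℚP.*-distribˡ-+ c a _))
maskedSum-scale (false ∷ m) c (a ∷ u) = maskedSum-scale m c u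

maskedSum-zero : ∀ {k} (m : Subset k) → maskedSum m (Vec.replicate k 0ℚ) ≡ 0ℚ
maskedSum-zero []          = refl
maskedSum-zero (true ∷ m)  = trans (ℚP.+-identityˡ _) (maskedSum-zero m)
maskedSum-zero (false ∷ m) = maskedSum-zero m

maskedSum-indicatorVec : ∀ {k} (m B : Subset k) → maskedSum m (indicatorVec B) ≡ fromℤ (+ ∣ B ∩ m ∣)
maskedSum-indicatorVec []          []          = refl
maskedSum-indicatorVec (true ∷ m)  (true ∷ B)  =
  trans (cong (1ℚ ℚ.+_) (maskedSum-indicatorVec m B)) (sym (fromℤ-+ (+ 1) (+ ∣ B ∩ m ∣)))
maskedSum-indicatorVec (true ∷ m)  (false ∷ B) = trans (ℚP.+-identityˡ _) (maskedSum-indicatorVec m B)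
maskedSum-indicatorVec (false ∷ m) (true ∷ B)  = maskedSum-indicatorVec m B
maskedSum-indicatorVec (false ∷ m) (false ∷ B) = maskedSum-indicatorVec m B

maskedSum-combination : ∀ {n} (m : Subset n) (comb : List (ℚ × Subset n)) →
  maskedSum m (combination comb) ≡ weightedSum (λ B → fromℤ (+ ∣ B ∩ m ∣)) comb
maskedSum-combination m []         = maskedSum-zero m
maskedSum-combination m (p ∷ comb) =
  trans (maskedSum-zipWith-+ m _ (combination comb))
        (cong₂ ℚ._+_ (trans (maskedSum-scale m (proj₁ p) _) (cong (proj₁ p ℚ.*_) (maskedSum-indicatorVec m (proj₂ p))))
                     (maskedSum-combination m comb))

maskedSum-fromℕ : ∀ {k} (m : Subset k) (a : Vec ℕ k) →
  maskedSum m (Vec.map fromℤ (Vec.map +_ a)) ≡ fromℤ (+ maskedSumℕ m a)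
maskedSum-fromℕ []          []       = refl
maskedSum-fromℕ (true ∷ m)  (a ∷ as) =
  trans (cong (fromℤ (+ a) ℚ.+_) (maskedSum-fromℕ m as)) (sym (fromℤ-+ (+ a) (+ maskedSumℕ m as)))
maskedSum-fromℕ (false ∷ m) (a ∷ as) = maskedSum-fromℕ m as

-- Integer points of t·P satisfy the defining inequalities

∣p∩q∣+∣p∩∁q∣≡∣p∣ : ∀ {n} (p q : Subset n) → ∣ p ∩ q ∣ ℕ.+ ∣ p ∩ ∁ q ∣ ≡ ∣ p ∣
∣p∩q∣+∣p∩∁q∣≡∣p∣ []          []          = refl
∣p∩q∣+∣p∩∁q∣≡∣p∣ (true ∷ p)  (true ∷ q)  = cong suc (∣p∩q∣+∣p∩∁q∣≡∣p∣ p q)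
∣p∩q∣+∣p∩∁q∣≡∣p∣ (true ∷ p)  (false ∷ q) = trans (ℕP.+-suc _ _) (cong suc (∣p∩q∣+∣p∩∁q∣≡∣p∣ p q))
∣p∩q∣+∣p∩∁q∣≡∣p∣ (false ∷ p) (_ ∷ q)     = ∣p∩q∣+∣p∩∁q∣≡∣p∣ p q

outside : ∀ s d → Subset (s ℕ.+ d)
outside s d = ∁ (initSeg (s ℕ.+ d) s)

∁-initSeg-zero : ∀ d → ∁ (initSeg d 0) ≡ ⊤
∁-initSeg-zero zero    = refl
∁-initSeg-zero (suc d) = cong (true ∷_) (∁-initSeg-zero d)

isPanBasis⇒outside-≤1 : ∀ r s d B → IsPanBasis r s (s ℕ.+ d) B → ∣ B ∩ outside s d ∣ ≤ 1
isPanBasis⇒outside-≤1 r s d B (∣B∣≡r , r-1≤inside) =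
  ℕP.+-cancelʳ-≤ (r ∸ 1) ∣ B ∩ outside s d ∣ 1 (begin
    ∣ B ∩ outside s d ∣ ℕ.+ (r ∸ 1)                    ≤⟨ ℕP.+-monoʳ-≤ ∣ B ∩ outside s d ∣ r-1≤inside ⟩
    ∣ B ∩ outside s d ∣ ℕ.+ ∣ B ∩ initSeg (s ℕ.+ d) s ∣ ≡⟨ ℕP.+-comm ∣ B ∩ outside s d ∣ _ ⟩
    ∣ B ∩ initSeg (s ℕ.+ d) s ∣ ℕ.+ ∣ B ∩ outside s d ∣ ≡⟨ ∣p∩q∣+∣p∩∁q∣≡∣p∣ B _ ⟩
    ∣ B ∣                                              ≡⟨ ∣B∣≡r ⟩
    r                                                  ≤⟨ ℕP.m≤n+m∸n r 1 ⟩
    1 ℕ.+ (r ∸ 1)                                      ∎)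
  where open ℕP.≤-Reasoning

outside-≤1⇒isPanBasis : ∀ r s d B → ∣ B ∣ ≡ r → ∣ B ∩ outside s d ∣ ≤ 1 → IsPanBasis r s (s ℕ.+ d) B
outside-≤1⇒isPanBasis r s d B ∣B∣≡r out≤1 = ∣B∣≡r , subst (r ∸ 1 ≤_) r∸outside≡inside (ℕP.∸-monoʳ-≤ r out≤1)
  where
  r∸outside≡inside : r ∸ ∣ B ∩ outside s d ∣ ≡ ∣ B ∩ initSeg (s ℕ.+ d) s ∣
  r∸outside≡inside = trans (cong (_∸ ∣ B ∩ outside s d ∣) (trans (sym ∣B∣≡r) (sym (∣p∩q∣+∣p∩∁q∣≡∣p∣ B _))))
                           (ℕP.m+n∸n≡m _ ∣ B ∩ outside s d ∣)

maskedSumℕ-⊤ : ∀ {k} (v : Vec ℕ k) → maskedSumℕ ⊤ v ≡ Vec.sum v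
maskedSumℕ-⊤ []      = refl
maskedSumℕ-⊤ (a ∷ v) = cong (a ℕ.+_) (maskedSumℕ-⊤ v)

maskedSumℕ-outside : ∀ {s d} (y : Vec ℕ s) (z : Vec ℕ d) → maskedSumℕ (outside s d) (y Vec.++ z) ≡ Vec.sum z
maskedSumℕ-outside {d = d} []      z = trans (cong (λ m → maskedSumℕ m z) (∁-initSeg-zero d)) (maskedSumℕ-⊤ z)
maskedSumℕ-outside         (_ ∷ y) z = maskedSumℕ-outside y z

vec-ext : ∀ {A : Set} {k} (u v : Vec A k) → (∀ j → Vec.lookup u j ≡ Vec.lookup v j) → u ≡ v
vec-ext u v u≗v = trans (sym (VecP.tabulate∘lookup u)) (trans (VecP.tabulate-cong u≗v) (VecP.tabulate∘lookup v))

natural-vector : ∀ t {k} (x : Vec ℤ k) →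
  (∀ j → 0ℚ ℚ.≤ fromℤ (Vec.lookup x j) × fromℤ (Vec.lookup x j) ℚ.≤ fromℤ (+ t)) →
  ∃ λ a → x ≡ Vec.map +_ a × VecAll.All (_≤ t) a
natural-vector t []      _      = [] , refl , []
natural-vector t (v ∷ x) bounds with bounds zero | natural-vector t x (λ j → bounds (suc j))
... | 0≤v , v≤t | a , x≡a , a≤t with fromℤ-cancel-≤ {+ 0} {v} 0≤v | fromℤ-cancel-≤ {v} {+ t} v≤t
... | +≤+ _ | +≤+ n≤t = _ ∷ a , cong (_ ∷_) x≡a , n≤t ∷ a≤t

module _ {r s d t : ℕ} {x : Vec ℤ (s ℕ.+ d)} (x∈ : InPanDilate r s (s ℕ.+ d) t x) where

  private
    n = s ℕ.+ d
    T = fromℤ (+ t)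
    comb = proj₁ x∈
    bases = proj₁ (proj₂ x∈)
    weights≥0 = proj₁ (proj₂ (proj₂ x∈))
    Σλ≡1 = proj₁ (proj₂ (proj₂ (proj₂ x∈)))
    x≡ = proj₂ (proj₂ (proj₂ (proj₂ x∈)))

    x≡t·combination : Vec.map fromℤ x ≡ Vec.map (T ℚ.*_) (combination comb)
    x≡t·combination = vec-ext _ _ λ j →
      trans (VecP.lookup-map j fromℤ x)
      (trans (x≡ j) (trans (cong (T ℚ.*_) (sym (lookup-combination comb j)))
                           (sym (VecP.lookup-map j (T ℚ.*_) (combination comb)))))

    scaled-bounds : (c : Subset n → ℚ) → All.All (λ p → 0ℚ ℚ.≤ c (proj₂ p) × c (proj₂ p) ℚ.≤ 1ℚ) comb →
                    0ℚ ℚ.≤ T ℚ.* weightedSum c comb × T ℚ.* weightedSum c comb ℚ.≤ T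
    scaled-bounds c c∈[0,1] =
      let 0≤Σ , Σ≤Σλ = weightedSum-bounds c comb weights≥0 c∈[0,1]
      in scale-bounds t _ 0≤Σ (subst (weightedSum c comb ℚ.≤_) Σλ≡1 Σ≤Σλ)

    coordinate-bounds : ∀ j → 0ℚ ℚ.≤ fromℤ (Vec.lookup x j) × fromℤ (Vec.lookup x j) ℚ.≤ T
    coordinate-bounds j =
      subst (λ q → 0ℚ ℚ.≤ q × q ℚ.≤ T) (sym (x≡ j))
            (scaled-bounds (λ B → indicator B j) (All.universal (λ p → indicator-bounds (proj₂ p) j) comb))

    a = proj₁ (natural-vector t x coordinate-bounds)
    x≡a = proj₁ (proj₂ (natural-vector t x coordinate-bounds))
    a≤t = proj₂ (proj₂ (natural-vector t x coordinate-bounds))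
    y = proj₁ (Vec.splitAt s a)
    z = proj₁ (proj₂ (Vec.splitAt s a))
    a≡y++z = proj₂ (proj₂ (Vec.splitAt s a))

    x≡y++z : x ≡ Vec.map +_ (y Vec.++ z)
    x≡y++z = trans x≡a (cong (λ v → Vec.map +_ v) a≡y++z)

    maskedSum-x : ∀ m → fromℤ (+ maskedSumℕ m (y Vec.++ z)) ≡ T ℚ.* weightedSum (λ B → fromℤ (+ ∣ B ∩ m ∣)) comb
    maskedSum-x m =
      trans (sym (maskedSum-fromℕ m (y Vec.++ z)))
      (trans (cong (λ v → maskedSum m (Vec.map fromℤ v)) (sym x≡y++z))
      (trans (cong (maskedSum m) x≡t·combination)
      (trans (maskedSum-scale m T (combination comb)) (cong (T ℚ.*_) (maskedSum-combination m comb)))))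

    total : Vec.sum y ℕ.+ Vec.sum z ≡ t ℕ.* r
    total = ℤP.+-injective (fromℤ-injective (begin
      fromℤ (+ (Vec.sum y ℕ.+ Vec.sum z))                  ≡⟨ cong (λ q → fromℤ (+ q))
                                                                   (sym (trans (maskedSumℕ-⊤ (y Vec.++ z)) (VecP.sum-++ y))) ⟩
      fromℤ (+ maskedSumℕ ⊤ (y Vec.++ z))                  ≡⟨ maskedSum-x ⊤ ⟩
      T ℚ.* weightedSum (λ B → fromℤ (+ ∣ B ∩ ⊤ ∣)) comb    ≡⟨ cong (T ℚ.*_) (weightedSum-constant _ (fromℤ (+ r)) comb
                                                                 (All.map (λ {p} → cong (λ q → fromℤ (+ q)) ∘ ∣B∩⊤∣≡r {proj₂ p}) bases)) ⟩
      T ℚ.* (sumℚ (List.map proj₁ comb) ℚ.* fromℤ (+ r))   ≡⟨ cong (λ q → T ℚ.* (q ℚ.* fromℤ (+ r))) Σλ≡1 ⟩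
      T ℚ.* (1ℚ ℚ.* fromℤ (+ r))                           ≡⟨ cong (T ℚ.*_) (ℚP.*-identityˡ _) ⟩
      T ℚ.* fromℤ (+ r)                                    ≡⟨ sym (fromℤ-* (+ t) (+ r)) ⟩
      fromℤ (+ t ℤ.* + r)                                  ≡⟨ cong fromℤ (sym (ℤP.pos-* t r)) ⟩
      fromℤ (+ (t ℕ.* r))                                  ∎))
      where
      open ≡-Reasoning
      ∣B∩⊤∣≡r : ∀ {B} → IsPanBasis r s n B → ∣ B ∩ ⊤ ∣ ≡ r
      ∣B∩⊤∣≡r {B} (∣B∣≡r , _) = trans (cong ∣_∣ (∩-identityʳ B)) ∣B∣≡r

    outsideSum≤t : Vec.sum z ≤ t
    outsideSum≤t =
      ℤP.drop‿+≤+ (fromℤ-cancel-≤ (subst (ℚ._≤ T) outsideSum (proj₂ (scaled-bounds outsideCount outsideCount∈[0,1]))))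
      where
      outsideCount : Subset n → ℚ
      outsideCount B = fromℤ (+ ∣ B ∩ outside s d ∣)
      outsideCount∈[0,1] : All.All (λ p → 0ℚ ℚ.≤ outsideCount (proj₂ p) × outsideCount (proj₂ p) ℚ.≤ 1ℚ) comb
      outsideCount∈[0,1] = All.map (λ {p} Bp →
        fromℕ-nonNegative ∣ proj₂ p ∩ outside s d ∣ ,
        fromℤ-mono-≤ {+ ∣ proj₂ p ∩ outside s d ∣} {+ 1} (+≤+ (isPanBasis⇒outside-≤1 r s d (proj₂ p) Bp))) bases
      outsideSum : T ℚ.* weightedSum outsideCount comb ≡ fromℤ (+ Vec.sum z)
      outsideSum = trans (sym (maskedSum-x (outside s d))) (cong (λ q → fromℤ (+ q)) (maskedSumℕ-outside y z))

  inPanDilate⇒panLatticePoint : PanLatticePoint r s d t x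
  inPanDilate⇒panLatticePoint =
    y , z , x≡y++z , proj₁ (VecAllP.++⁻ y (subst (VecAll.All (_≤ t)) a≡y++z a≤t)) , total , outsideSum≤t

rotateIncrement : ℕ → List ℕ → List ℕ
rotateIncrement c S = drop c S ++ List.map suc (take c S)

Balanced : ℕ → List ℕ → Set
Balanced t S = ∃ λ q → ∃ λ a → ∃ λ b → S ≡ replicate a q ++ replicate b (suc q) × a ℕ.+ b ≡ t

private
  take-replicate-++ : ∀ c a (x : ℕ) ys → c ≤ a → take c (replicate a x ++ ys) ≡ replicate c x
  take-replicate-++ zero    a       x ys _         = refl
  take-replicate-++ (suc c) (suc a) x ys (s≤s c≤a) = cong (x ∷_) (take-replicate-++ c a x ys c≤a)

  drop-replicate-++ : ∀ c a (x : ℕ) ys → c ≤ a → drop c (replicate a x ++ ys) ≡ replicate (a ∸ c) x ++ ys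
  drop-replicate-++ zero    a       x ys _         = refl
  drop-replicate-++ (suc c) (suc a) x ys (s≤s c≤a) = drop-replicate-++ c a x ys c≤a

  take-replicate-++-≥ : ∀ c a (x : ℕ) ys → a ≤ c → take c (replicate a x ++ ys) ≡ replicate a x ++ take (c ∸ a) ys
  take-replicate-++-≥ c       zero    x ys _         = refl
  take-replicate-++-≥ (suc c) (suc a) x ys (s≤s a≤c) = cong (x ∷_) (take-replicate-++-≥ c a x ys a≤c)

  drop-replicate-++-≥ : ∀ c a (x : ℕ) ys → a ≤ c → drop c (replicate a x ++ ys) ≡ drop (c ∸ a) ys
  drop-replicate-++-≥ c       zero    x ys _         = refl
  drop-replicate-++-≥ (suc c) (suc a) x ys (s≤s a≤c) = drop-replicate-++-≥ c a x ys a≤c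

  replicate-++ : ∀ a b (x : ℕ) → replicate a x ++ replicate b x ≡ replicate (a ℕ.+ b) x
  replicate-++ zero    b x = refl
  replicate-++ (suc a) b x = cong (x ∷_) (replicate-++ a b x)

  take-replicate : ∀ c b (x : ℕ) → c ≤ b → take c (replicate b x) ≡ replicate c x
  take-replicate c b x c≤b =
    trans (cong (take c) (sym (ListP.++-identityʳ (replicate b x)))) (take-replicate-++ c b x [] c≤b)

  drop-replicate : ∀ c b (x : ℕ) → c ≤ b → drop c (replicate b x) ≡ replicate (b ∸ c) x
  drop-replicate c b x c≤b =
    trans (cong (drop c) (sym (ListP.++-identityʳ (replicate b x))))
          (trans (drop-replicate-++ c b x [] c≤b) (ListP.++-identityʳ _))

balanced-rotateIncrement-≤ : ∀ t c q a b → c ≤ a → a ℕ.+ b ≡ t →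
  Balanced t (rotateIncrement c (replicate a q ++ replicate b (suc q)))
balanced-rotateIncrement-≤ t c q a b c≤a a+b≡t = q , a ∸ c , b ℕ.+ c ,
  (begin
    drop c (replicate a q ++ replicate b (suc q)) ++ List.map suc (take c (replicate a q ++ replicate b (suc q)))
  ≡⟨ cong₂ _++_ (drop-replicate-++ c a q _ c≤a) (cong (List.map suc) (take-replicate-++ c a q _ c≤a)) ⟩
    (replicate (a ∸ c) q ++ replicate b (suc q)) ++ List.map suc (replicate c q)
  ≡⟨ cong ((replicate (a ∸ c) q ++ replicate b (suc q)) ++_) (ListP.map-replicate suc c q) ⟩
    (replicate (a ∸ c) q ++ replicate b (suc q)) ++ replicate c (suc q)
  ≡⟨ ListP.++-assoc (replicate (a ∸ c) q) _ _ ⟩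
    replicate (a ∸ c) q ++ (replicate b (suc q) ++ replicate c (suc q))
  ≡⟨ cong (replicate (a ∸ c) q ++_) (replicate-++ b c (suc q)) ⟩
    replicate (a ∸ c) q ++ replicate (b ℕ.+ c) (suc q)
  ∎) ,
  (begin
    a ∸ c ℕ.+ (b ℕ.+ c) ≡⟨ reorder (a ∸ c) b c ⟩
    b ℕ.+ (a ∸ c ℕ.+ c) ≡⟨ cong (b ℕ.+_) (ℕP.m∸n+n≡m c≤a) ⟩
    b ℕ.+ a             ≡⟨ trans (ℕP.+-comm b a) a+b≡t ⟩
    t                   ∎)
  where
  open ≡-Reasoning
  reorder : ∀ x b c → x ℕ.+ (b ℕ.+ c) ≡ b ℕ.+ (x ℕ.+ c)
  reorder = ℕSolver.solve-∀

balanced-rotateIncrement-> : ∀ t c q a b → a ≤ c → c ≤ t → a ℕ.+ b ≡ t →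
  Balanced t (rotateIncrement c (replicate a q ++ replicate b (suc q)))
balanced-rotateIncrement-> t c q a b a≤c c≤t a+b≡t = suc q , b ∸ e ℕ.+ a , e ,
  (begin
    drop c (replicate a q ++ replicate b (suc q)) ++ List.map suc (take c (replicate a q ++ replicate b (suc q)))
  ≡⟨ cong₂ _++_ (trans (drop-replicate-++-≥ c a q _ a≤c) (drop-replicate e b (suc q) e≤b))
                (cong (List.map suc) (trans (take-replicate-++-≥ c a q _ a≤c)
                                            (cong (replicate a q ++_) (take-replicate e b (suc q) e≤b)))) ⟩
    replicate (b ∸ e) (suc q) ++ List.map suc (replicate a q ++ replicate e (suc q))
  ≡⟨ cong (replicate (b ∸ e) (suc q) ++_)
          (trans (ListP.map-++ suc (replicate a q) _)
                 (cong₂ _++_ (ListP.map-replicate suc a q) (ListP.map-replicate suc e (suc q)))) ⟩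
    replicate (b ∸ e) (suc q) ++ (replicate a (suc q) ++ replicate e (suc (suc q)))
  ≡⟨ sym (ListP.++-assoc (replicate (b ∸ e) (suc q)) _ _) ⟩
    (replicate (b ∸ e) (suc q) ++ replicate a (suc q)) ++ replicate e (suc (suc q))
  ≡⟨ cong (_++ replicate e (suc (suc q))) (replicate-++ (b ∸ e) a (suc q)) ⟩
    replicate (b ∸ e ℕ.+ a) (suc q) ++ replicate e (suc (suc q))
  ∎) ,
  (begin
    b ∸ e ℕ.+ a ℕ.+ e   ≡⟨ reorder (b ∸ e) a e ⟩
    a ℕ.+ (b ∸ e ℕ.+ e) ≡⟨ cong (a ℕ.+_) (ℕP.m∸n+n≡m e≤b) ⟩
    a ℕ.+ b             ≡⟨ a+b≡t ⟩
    t                   ∎)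
  where
  open ≡-Reasoning
  e = c ∸ a
  e≤b : e ≤ b
  e≤b = subst (c ∸ a ≤_) (ℕP.m+n∸m≡n a b) (ℕP.∸-monoˡ-≤ a (subst (c ≤_) (sym a+b≡t) c≤t))
  reorder : ∀ x a e → x ℕ.+ a ℕ.+ e ≡ a ℕ.+ (x ℕ.+ e)
  reorder = ℕSolver.solve-∀

balanced-rotateIncrement : ∀ t c S → c ≤ t → Balanced t S → Balanced t (rotateIncrement c S)
balanced-rotateIncrement t c S c≤t (q , a , b , refl , a+b≡t) with c ℕ.≤? a
... | yes c≤a = balanced-rotateIncrement-≤ t c q a b c≤a a+b≡t
... | no  c≰a = balanced-rotateIncrement-> t c q a b (ℕP.<⇒≤ (ℕP.≰⇒> c≰a)) c≤t a+b≡t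

sum-replicate : ∀ n x → sum (replicate n x) ≡ n ℕ.* x
sum-replicate zero    x = refl
sum-replicate (suc n) x = cong (x ℕ.+_) (sum-replicate n x)

sum-balanced : ∀ {t q a b} → a ℕ.+ b ≡ t → sum (replicate a q ++ replicate b (suc q)) ≡ t ℕ.* q ℕ.+ b
sum-balanced {q = q} {a} {b} refl =
  trans (ListActionP.sum-++ (replicate a q) (replicate b (suc q)))
        (trans (cong₂ ℕ._+_ (sum-replicate a q) (sum-replicate b (suc q))) (expand a b q))
  where expand : ∀ a b q → a ℕ.* q ℕ.+ b ℕ.* (1 ℕ.+ q) ≡ (a ℕ.+ b) ℕ.* q ℕ.+ b
        expand = ℕSolver.solve-∀

quotient-unique : ∀ t q r b → b < t → t ℕ.* q ℕ.+ b ≡ t ℕ.* r → q ≡ r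
quotient-unique t q r b b<t tq+b≡tr with ℕP.<-cmp q r
... | tri≈ _ q≡r _ = q≡r
... | tri< q<r _ _ = ⊥-elim (ℕP.<-irrefl tq+b≡tr (begin-strict
  t ℕ.* q ℕ.+ b      <⟨ ℕP.+-monoʳ-< (t ℕ.* q) b<t ⟩
  t ℕ.* q ℕ.+ t      ≡⟨ trans (ℕP.+-comm (t ℕ.* q) t) (sym (ℕP.*-suc t q)) ⟩
  t ℕ.* suc q        ≤⟨ ℕP.*-monoʳ-≤ t q<r ⟩
  t ℕ.* r            ∎))
  where open ℕP.≤-Reasoning
... | tri> _ _ r<q = ⊥-elim (ℕP.<-irrefl (sym tq+b≡tr) (begin-strict
  t ℕ.* r            <⟨ ℕP.m<m+n (t ℕ.* r) (ℕP.≤-<-trans z≤n b<t) ⟩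
  t ℕ.* r ℕ.+ t      ≡⟨ trans (ℕP.+-comm (t ℕ.* r) t) (sym (ℕP.*-suc t r)) ⟩
  t ℕ.* suc r        ≤⟨ ℕP.*-monoʳ-≤ t r<q ⟩
  t ℕ.* q            ≤⟨ ℕP.m≤m+n (t ℕ.* q) b ⟩
  t ℕ.* q ℕ.+ b      ∎))
  where open ℕP.≤-Reasoning

balanced-sum≡t*r⇒all≡r : ∀ t r S → 1 ≤ t → Balanced t S → sum S ≡ t ℕ.* r → All.All (_≡ r) S
balanced-sum≡t*r⇒all≡r t r S 1≤t (q , a , b , refl , a+b≡t) ΣS≡tr
  with ℕP.m≤n⇒m<n∨m≡n (subst (b ≤_) a+b≡t (ℕP.m≤n+m b a))
... | inj₁ b<t = AllP.++⁺ (AllP.replicate⁺ a q≡r) (subst (λ k → All.All (_≡ r) (replicate k (suc q))) (sym b≡0) [])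
  where
  tq+b≡tr : t ℕ.* q ℕ.+ b ≡ t ℕ.* r
  tq+b≡tr = trans (sym (sum-balanced a+b≡t)) ΣS≡tr
  q≡r : q ≡ r
  q≡r = quotient-unique t q r b b<t tq+b≡tr
  b≡0 : b ≡ 0
  b≡0 = ℕP.+-cancelˡ-≡ (t ℕ.* q) b 0 (trans tq+b≡tr (trans (cong (t ℕ.*_) (sym q≡r)) (sym (ℕP.+-identityʳ _))))
... | inj₂ b≡t = AllP.++⁺ (subst (λ k → All.All (_≡ r) (replicate k q)) (sym a≡0) []) (AllP.replicate⁺ b 1+q≡r)
  where
  a≡0 : a ≡ 0
  a≡0 = ℕP.+-cancelʳ-≡ b a 0 (trans a+b≡t (sym b≡t))
  instance _ = ℕ.>-nonZero 1≤t
  1+q≡r : suc q ≡ r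
  1+q≡r = ℕP.*-cancelˡ-≡ (suc q) r t
    (trans (trans (ℕP.*-suc t q) (trans (ℕP.+-comm t (t ℕ.* q)) (cong (t ℕ.* q ℕ.+_) (sym b≡t))))
           (trans (sym (sum-balanced a+b≡t)) ΣS≡tr))

balanced-sum≤t⇒all≤1 : ∀ t S → Balanced t S → sum S ≤ t → All.All (_≤ 1) S
balanced-sum≤t⇒all≤1 t S (zero , a , b , refl , _) _ = AllP.++⁺ (AllP.replicate⁺ a z≤n) (AllP.replicate⁺ b ℕP.≤-refl)
balanced-sum≤t⇒all≤1 t S (suc q , zero , zero , refl , _) _ = []
balanced-sum≤t⇒all≤1 t S (suc zero , suc a , zero , refl , _) _ = AllP.++⁺ (AllP.replicate⁺ (suc a) ℕP.≤-refl) []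
-- In the remaining cases every entry is at least 1 and some entry at least 2.
balanced-sum≤t⇒all≤1 t S (suc (suc q) , suc a , zero , refl , a+0≡t) ΣS≤t =
  ⊥-elim (ℕP.<-irrefl refl (ℕP.<-≤-trans (ℕP.m<m*n t (suc (suc q)) (s≤s (s≤s z≤n)))
    (subst (_≤ t) (trans (sum-balanced a+0≡t) (ℕP.+-identityʳ _)) ΣS≤t)))
  where instance _ = subst ℕ.NonZero a+0≡t _
balanced-sum≤t⇒all≤1 t S (suc q , a , suc b , refl , a+b≡t) ΣS≤t =
  ⊥-elim (ℕP.<-irrefl refl (ℕP.<-≤-trans
    (ℕP.≤-<-trans (ℕP.m≤m+n t (t ℕ.* q)) (ℕP.m<m+n (t ℕ.+ t ℕ.* q) {suc b} (s≤s z≤n)))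
    (subst (_≤ t) (trans (sum-balanced a+b≡t) (cong (ℕ._+ suc b) (ℕP.*-suc t q))) ΣS≤t)))

sum-map-suc : ∀ X → sum (List.map suc X) ≡ sum X ℕ.+ length X
sum-map-suc []      = refl
sum-map-suc (x ∷ X) = trans (cong (λ k → suc (x ℕ.+ k)) (sum-map-suc X))
                            (trans (cong suc (sym (ℕP.+-assoc x _ _))) (sym (ℕP.+-suc _ _)))

sum-rotateIncrement : ∀ c S → c ≤ length S → sum (rotateIncrement c S) ≡ sum S ℕ.+ c
sum-rotateIncrement c S c≤∣S∣ =
  begin
    sum (drop c S ++ List.map suc (take c S))
  ≡⟨ ListActionP.sum-++ (drop c S) _ ⟩
    sum (drop c S) ℕ.+ sum (List.map suc (take c S))
  ≡⟨ cong (sum (drop c S) ℕ.+_) (sum-map-suc (take c S)) ⟩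
    sum (drop c S) ℕ.+ (sum (take c S) ℕ.+ length (take c S))
  ≡⟨ cong (λ k → sum (drop c S) ℕ.+ (sum (take c S) ℕ.+ k)) (trans (ListP.length-take c S) (ℕP.m≤n⇒m⊓n≡m c≤∣S∣)) ⟩
    sum (drop c S) ℕ.+ (sum (take c S) ℕ.+ c)
  ≡⟨ reorder (sum (drop c S)) (sum (take c S)) c ⟩
    sum (take c S) ℕ.+ sum (drop c S) ℕ.+ c
  ≡⟨ cong (ℕ._+ c) (trans (sym (ListActionP.sum-++ (take c S) (drop c S))) (cong sum (ListP.take++drop≡id c S))) ⟩
    sum S ℕ.+ c
  ∎
  where
  open ≡-Reasoning
  reorder : ∀ D T c → D ℕ.+ (T ℕ.+ c) ≡ T ℕ.+ D ℕ.+ c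
  reorder = ℕSolver.solve-∀

length-rotate : ∀ {A B : Set} (f g : A → B) c (X : List A) →
  length (List.map f (drop c X) ++ List.map g (take c X)) ≡ length X
length-rotate f g c X =
  begin
    length (List.map f (drop c X) ++ List.map g (take c X))
  ≡⟨ ListP.length-++ (List.map f (drop c X)) ⟩
    length (List.map f (drop c X)) ℕ.+ length (List.map g (take c X))
  ≡⟨ cong₂ ℕ._+_ (ListP.length-map f (drop c X)) (ListP.length-map g (take c X)) ⟩
    length (drop c X) ℕ.+ length (take c X)
  ≡⟨ ℕP.+-comm (length (drop c X)) _ ⟩
    length (take c X) ℕ.+ length (drop c X)
  ≡⟨ sym (ListP.length-++ (take c X)) ⟩
    length (take c X ++ drop c X)
  ≡⟨ cong length (ListP.take++drop≡id c X) ⟩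
    length X
  ∎
  where open ≡-Reasoning

-- Decomposing a lattice point into t bases

addCoordinate : ∀ {k} → ℕ → List (Subset k) → List (Subset (suc k))
addCoordinate c X = List.map (false ∷_) (drop c X) ++ List.map (true ∷_) (take c X)

-- t sets, coordinate j lying in v_j of them. The list is kept sorted by size,
-- so each coordinate goes into the currently smallest sets and sizes stay balanced.
roundRobin : ∀ {k} → ℕ → Vec ℕ k → List (Subset k)
roundRobin t []      = replicate t []
roundRobin t (c ∷ v) = addCoordinate c (roundRobin t v)

sizes-addCoordinate : ∀ {k} c (X : List (Subset k)) → List.map ∣_∣ (addCoordinate c X) ≡ rotateIncrement c (List.map ∣_∣ X)
sizes-addCoordinate c X =
  -- ∣ false ∷ B ∣ and ∣ true ∷ B ∣ compute to ∣ B ∣ and suc ∣ B ∣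
  trans (ListP.map-++ ∣_∣ (List.map (false ∷_) (drop c X)) _)
        (cong₂ _++_ (trans (sym (ListP.map-∘ (drop c X))) (sym (ListP.drop-map c X)))
                    (trans (sym (ListP.map-∘ (take c X)))
                           (trans (ListP.map-∘ (take c X)) (cong (List.map suc) (sym (ListP.take-map c X))))))

length-roundRobin : ∀ {k} t (v : Vec ℕ k) → length (roundRobin t v) ≡ t
length-roundRobin t []      = ListP.length-replicate t
length-roundRobin t (c ∷ v) = trans (length-rotate (false ∷_) (true ∷_) c (roundRobin t v)) (length-roundRobin t v)

balanced-roundRobin : ∀ {k} t (v : Vec ℕ k) → VecAll.All (_≤ t) v → Balanced t (List.map ∣_∣ (roundRobin t v))
balanced-roundRobin t []      []          =
  0 , t , 0 , trans (ListP.map-replicate ∣_∣ t []) (sym (ListP.++-identityʳ _)) , ℕP.+-identityʳ t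
balanced-roundRobin t (c ∷ v) (c≤t ∷ v≤t) =
  subst (Balanced t) (sym (sizes-addCoordinate c (roundRobin t v)))
        (balanced-rotateIncrement t c _ c≤t (balanced-roundRobin t v v≤t))

sum-sizes-roundRobin : ∀ {k} t (v : Vec ℕ k) → VecAll.All (_≤ t) v → sum (List.map ∣_∣ (roundRobin t v)) ≡ Vec.sum v
sum-sizes-roundRobin t []      []          =
  trans (cong sum (ListP.map-replicate ∣_∣ t [])) (trans (sum-replicate t 0) (ℕP.*-zeroʳ t))
sum-sizes-roundRobin t (c ∷ v) (c≤t ∷ v≤t) =
  trans (cong sum (sizes-addCoordinate c (roundRobin t v)))
  (trans (sum-rotateIncrement c _ (subst (c ≤_) (sym (trans (ListP.length-map ∣_∣ (roundRobin t v)) (length-roundRobin t v))) c≤t))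
  (trans (cong (ℕ._+ c) (sum-sizes-roundRobin t v v≤t)) (ℕP.+-comm _ c)))

multiplicity : ∀ {k} → Fin k → List (Subset k) → ℕ
multiplicity j X = sum (List.map (λ B → if Vec.lookup B j then 1 else 0) X)

multiplicity-++ : ∀ {k} j (X Y : List (Subset k)) → multiplicity j (X ++ Y) ≡ multiplicity j X ℕ.+ multiplicity j Y
multiplicity-++ j X Y = trans (cong sum (ListP.map-++ _ X Y)) (ListActionP.sum-++ (List.map _ X) _)

multiplicity-zero-false : ∀ {k} (X : List (Subset k)) → multiplicity zero (List.map (false ∷_) X) ≡ 0
multiplicity-zero-false []      = refl
multiplicity-zero-false (B ∷ X) = multiplicity-zero-false X

multiplicity-zero-true : ∀ {k} (X : List (Subset k)) → multiplicity zero (List.map (true ∷_) X) ≡ length X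
multiplicity-zero-true []      = refl
multiplicity-zero-true (B ∷ X) = cong suc (multiplicity-zero-true X)

multiplicity-suc : ∀ {k} b j (X : List (Subset k)) → multiplicity (suc j) (List.map (b ∷_) X) ≡ multiplicity j X
multiplicity-suc b j []      = refl
multiplicity-suc b j (B ∷ X) = cong (_ ℕ.+_) (multiplicity-suc b j X)

multiplicity-addCoordinate-zero : ∀ {k} c (X : List (Subset k)) → c ≤ length X → multiplicity zero (addCoordinate c X) ≡ c
multiplicity-addCoordinate-zero c X c≤∣X∣ =
  trans (multiplicity-++ zero (List.map (false ∷_) (drop c X)) _)
        (trans (cong₂ ℕ._+_ (multiplicity-zero-false (drop c X)) (multiplicity-zero-true (take c X)))
               (trans (ListP.length-take c X) (ℕP.m≤n⇒m⊓n≡m c≤∣X∣)))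

multiplicity-addCoordinate-suc : ∀ {k} c j (X : List (Subset k)) → multiplicity (suc j) (addCoordinate c X) ≡ multiplicity j X
multiplicity-addCoordinate-suc c j X =
  trans (multiplicity-++ (suc j) (List.map (false ∷_) (drop c X)) _)
  (trans (cong₂ ℕ._+_ (multiplicity-suc false j (drop c X)) (multiplicity-suc true j (take c X)))
  (trans (ℕP.+-comm (multiplicity j (drop c X)) _)
  (trans (sym (multiplicity-++ j (take c X) (drop c X))) (cong (multiplicity j) (ListP.take++drop≡id c X)))))

multiplicity-roundRobin : ∀ {k} t (v : Vec ℕ k) → VecAll.All (_≤ t) v → ∀ j → multiplicity j (roundRobin t v) ≡ Vec.lookup v j
multiplicity-roundRobin t (c ∷ v) (c≤t ∷ v≤t) zero =
  multiplicity-addCoordinate-zero c (roundRobin t v) (subst (c ≤_) (sym (length-roundRobin t v)) c≤t)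
multiplicity-roundRobin t (c ∷ v) (c≤t ∷ v≤t) (suc j) =
  trans (multiplicity-addCoordinate-suc c j (roundRobin t v)) (multiplicity-roundRobin t v v≤t j)

-- On the last d coordinates, roundRobin t (y ++ z) consists of the sets of roundRobin t z.
outside-roundRobin : ∀ t {s d} (y : Vec ℕ s) (z : Vec ℕ d) → All.All (λ B → ∣ B ∣ ≤ 1) (roundRobin t z) →
  All.All (λ B → ∣ B ∩ outside s d ∣ ≤ 1) (roundRobin t (y Vec.++ z))
outside-roundRobin t {d = d} [] z ∣B∣≤1 =
  All.map (λ {B} → subst (_≤ 1) (sym (trans (cong (λ m → ∣ B ∩ m ∣) (∁-initSeg-zero d)) (cong ∣_∣ (∩-identityʳ B)))))
          ∣B∣≤1
outside-roundRobin t (c ∷ y) z ∣B∣≤1 =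
  let rest = outside-roundRobin t y z ∣B∣≤1
  in AllP.++⁺ (AllP.map⁺ (AllP.drop⁺ c rest)) (AllP.map⁺ (AllP.take⁺ c rest))

firstElements : ∀ r s d → r ≤ s → Subset (s ℕ.+ d)
firstElements zero    s       d _         = ⊥
firstElements (suc r) (suc s) d (s≤s r≤s) = true ∷ firstElements r s d r≤s

firstElements-isPanBasis : ∀ r s d r≤s → IsPanBasis r s (s ℕ.+ d) (firstElements r s d r≤s)
firstElements-isPanBasis r s d r≤s = size r s d r≤s , subst (r ∸ 1 ≤_) (sym (inside r s d r≤s)) (ℕP.m∸n≤m r 1)
  where
  size : ∀ r s d r≤s → ∣ firstElements r s d r≤s ∣ ≡ r
  size zero    s       d _         = ∣⊥∣≡0 (s ℕ.+ d)
  size (suc r) (suc s) d (s≤s r≤s) = cong suc (size r s d r≤s)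
  inside : ∀ r s d r≤s → ∣ firstElements r s d r≤s ∩ initSeg (s ℕ.+ d) s ∣ ≡ r
  inside zero    s       d _         = trans (cong ∣_∣ (∩-zeroˡ (initSeg (s ℕ.+ d) s))) (∣⊥∣≡0 (s ℕ.+ d))
  inside (suc r) (suc s) d (s≤s r≤s) = cong suc (inside r s d r≤s)

module _ (t′ : ℕ) where

  private
    t = suc t′
    T = fromℤ (+ t)

    T⁺ : ℚ
    T⁺ = mkℚ (+ t) 0 (λ (_ , d∣1) → ∣1⇒≡1 d∣1)

  1/t : ℚ
  1/t = ℚ.1/ T⁺

  T*1/t≡1 : T ℚ.* 1/t ≡ 1ℚ
  T*1/t≡1 = trans (cong (ℚ._* 1/t) (fromℤ-mkℚ (+ t))) (ℚP.*-inverseʳ T⁺)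

  uniform : ∀ {n} → List (Subset n) → List (ℚ × Subset n)
  uniform = List.map (1/t ,_)

  sum-weights-uniform : ∀ {n} (X : List (Subset n)) → sumℚ (List.map proj₁ (uniform X)) ≡ fromℤ (+ length X) ℚ.* 1/t
  sum-weights-uniform []      = sym (ℚP.*-zeroˡ 1/t)
  sum-weights-uniform (B ∷ X) =
    trans (cong (1/t ℚ.+_) (sum-weights-uniform X))
    (trans (cong (ℚ._+ fromℤ (+ length X) ℚ.* 1/t) (sym (ℚP.*-identityˡ 1/t)))
    (trans (sym (ℚP.*-distribʳ-+ 1/t 1ℚ (fromℤ (+ length X)))) (cong (ℚ._* 1/t) (sym (fromℤ-+ (+ 1) (+ length X))))))

  weightedSum-indicator-uniform : ∀ {n} j (X : List (Subset n)) →
    weightedSum (λ B → indicator B j) (uniform X) ≡ 1/t ℚ.* fromℤ (+ multiplicity j X)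
  weightedSum-indicator-uniform j []      = sym (ℚP.*-zeroʳ 1/t)
  weightedSum-indicator-uniform j (B ∷ X) with Vec.lookup B j
  ... | true  = trans (cong (1/t ℚ.* 1ℚ ℚ.+_) (weightedSum-indicator-uniform j X))
                 (trans (sym (ℚP.*-distribˡ-+ 1/t 1ℚ (fromℤ (+ multiplicity j X))))
                        (cong (1/t ℚ.*_) (sym (fromℤ-+ (+ 1) (+ multiplicity j X)))))
  ... | false = trans (cong₂ ℚ._+_ (ℚP.*-zeroʳ 1/t) (weightedSum-indicator-uniform j X))
                      (ℚP.+-identityˡ (1/t ℚ.* fromℤ (+ multiplicity j X)))

  panLatticePoint⇒inPanDilate-suc : ∀ {r s d} (x : Vec ℤ (s ℕ.+ d)) → PanLatticePoint r s d t x → InPanDilate r s (s ℕ.+ d) t x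
  panLatticePoint⇒inPanDilate-suc {r} {s} {d} _ (y , z , refl , y≤t , total , Σz≤t) =
    uniform Bs , AllP.map⁺ bases , AllP.map⁺ (All.universal (λ _ → ℚP.nonNegative⁻¹ 1/t) Bs) , Σweights≡1 , coordinates
    where
    a = y Vec.++ z
    z≤t : VecAll.All (_≤ t) z
    z≤t = VecAll.map (λ b≤Σz → ℕP.≤-trans b≤Σz Σz≤t) (entries-≤-sum z)
    a≤t : VecAll.All (_≤ t) a
    a≤t = VecAllP.++⁺ y≤t z≤t
    Bs = roundRobin t a
    sizes : All.All (λ B → ∣ B ∣ ≡ r) Bs
    sizes = AllP.map⁻ (balanced-sum≡t*r⇒all≡r t r _ (s≤s z≤n) (balanced-roundRobin t a a≤t)
                        (trans (sum-sizes-roundRobin t a a≤t) (trans (VecP.sum-++ y) total)))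
    outsideSizes : All.All (λ B → ∣ B ∣ ≤ 1) (roundRobin t z)
    outsideSizes = AllP.map⁻ (balanced-sum≤t⇒all≤1 t _ (balanced-roundRobin t z z≤t)
                               (subst (_≤ t) (sym (sum-sizes-roundRobin t z z≤t)) Σz≤t))
    bases : All.All (IsPanBasis r s (s ℕ.+ d)) Bs
    bases = All.zipWith (λ {B} (∣B∣≡r , out≤1) → outside-≤1⇒isPanBasis r s d B ∣B∣≡r out≤1)
                        (sizes , outside-roundRobin t y z outsideSizes)
    Σweights≡1 : sumℚ (List.map proj₁ (uniform Bs)) ≡ 1ℚ
    Σweights≡1 = trans (sum-weights-uniform Bs) (trans (cong (λ q → fromℤ (+ q) ℚ.* 1/t) (length-roundRobin t a)) T*1/t≡1)
    coordinates : ∀ j → fromℤ (Vec.lookup (Vec.map +_ a) j) ≡ T ℚ.* weightedSum (λ B → indicator B j) (uniform Bs)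
    coordinates j = sym (begin
      T ℚ.* weightedSum (λ B → indicator B j) (uniform Bs) ≡⟨ cong (T ℚ.*_) (weightedSum-indicator-uniform j Bs) ⟩
      T ℚ.* (1/t ℚ.* fromℤ (+ multiplicity j Bs))           ≡⟨ sym (ℚP.*-assoc T 1/t _) ⟩
      (T ℚ.* 1/t) ℚ.* fromℤ (+ multiplicity j Bs)           ≡⟨ cong (ℚ._* fromℤ (+ multiplicity j Bs)) T*1/t≡1 ⟩
      1ℚ ℚ.* fromℤ (+ multiplicity j Bs)                    ≡⟨ ℚP.*-identityˡ _ ⟩
      fromℤ (+ multiplicity j Bs)                           ≡⟨ cong (λ q → fromℤ (+ q)) (multiplicity-roundRobin t a a≤t j) ⟩
      fromℤ (+ Vec.lookup a j)                              ≡⟨ cong fromℤ (sym (VecP.lookup-map j +_ a)) ⟩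
      fromℤ (Vec.lookup (Vec.map +_ a) j)                   ∎)
      where open ≡-Reasoning

panLatticePoint⇒inPanDilate : ∀ {r s d t} (x : Vec ℤ (s ℕ.+ d)) → r ≤ s → PanLatticePoint r s d t x → InPanDilate r s (s ℕ.+ d) t x
panLatticePoint⇒inPanDilate {t = suc t′} x _ x∈ = panLatticePoint⇒inPanDilate-suc t′ x x∈
panLatticePoint⇒inPanDilate {r} {s} {d} {zero} _ r≤s (y , z , refl , y≤0 , _ , Σz≤0) =
  (1ℚ , B) ∷ [] , firstElements-isPanBasis r s d r≤s ∷ [] , 0≤1 ∷ [] , ℚP.+-identityʳ 1ℚ , coordinates
  where
  B = firstElements r s d r≤s
  a≤0 : VecAll.All (_≤ 0) (y Vec.++ z)
  a≤0 = VecAllP.++⁺ y≤0 (VecAll.map (λ b≤Σz → ℕP.≤-trans b≤Σz Σz≤0) (entries-≤-sum z))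
  coordinates : ∀ j → fromℤ (Vec.lookup (Vec.map +_ (y Vec.++ z)) j) ≡
                      fromℤ (+ 0) ℚ.* weightedSum (λ B → indicator B j) ((1ℚ , B) ∷ [])
  coordinates j =
    trans (cong fromℤ (trans (VecP.lookup-map j +_ (y Vec.++ z)) (cong +_ (ℕP.n≤0⇒n≡0 (VecAllP.lookup⁺ a≤0 j)))))
          (sym (ℚP.*-zeroˡ (weightedSum (λ B → indicator B j) ((1ℚ , B) ∷ []))))

s<n⇒∃+suc : ∀ {s n} → s < n → ∃ λ d′ → s ℕ.+ suc d′ ≡ n
s<n⇒∃+suc {s} {n} s<n = n ∸ suc s , trans (ℕP.+-suc s (n ∸ suc s)) (ℕP.m+[n∸m]≡n s<n)

theorem5p2 : (r s n t : ℕ) → 1 ≤ s → r ≤ s → s < n →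
    Σ ℕ (λ k → PanEhrIs r s n t k × (+ k ≡ panRHS r s n t))
theorem5p2 r (suc s′) n t (s≤s z≤n) r≤s s<n with s<n⇒∃+suc s<n
... | d′ , refl =
  length panLatticePoints ,
  (panLatticePoints , panLatticePoints-unique ,
   (λ x → mk⇔ (λ x∈ → panLatticePoint⇒inPanDilate x r≤s (∈-panLatticePoints⁻ r≤s x∈))
              (λ x∈tP → ∈-panLatticePoints⁺ r≤s (inPanDilate⇒panLatticePoint x∈tP))) ,
   refl) ,
  length-panLatticePoints r s′ d′ t r≤s
  where open PanLatticePoints r (suc s′) (suc d′) t
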